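{- Let $P$ be a program and let $B$ be a set of pattern rules that is correct w.r.t. $P$. Suppose that $\mathit{patunf}(P,B)$ contains a special pattern rule $r=(p,q)$. Then for all $n\in\mathbb N$ with $n\ge\alpha(r)$ and all $\theta\in S(\Sigma,X)$, there is an infinite $\Rightarrow_P$-chain that starts from $\langle p(n)\theta\rangle$.
   Context: Fix a signature $\Sigma$, a special constant $\mathsf{e}$ (also denoting the empty sequence), hole constants $\square_1,\square_2,\dots$ and an infinite countable set $X$ of variables, pairwise disjoint. $T(\Sigma,X)$ is the set of terms, $S(\Sigma,X)$ the set of substitutions; composition $x(\sigma\theta)=(x\sigma)\theta$, $\emptyset$ the identity, $\sigma^0=\emptyset$, $\sigma^{n+1}=\sigma^n\sigma$, $\mathsf{e}\theta=\mathsf{e}$; $\sigma$ commutes with $\theta$ if $x\sigma\theta=x\theta\sigma$ for all $x$. Renamings are bijective substitutions on $X$; $\mathit{mgu}$ denotes most general unifiers (componentwise on sequences). An $m$-context is a term over $\Sigma\cup\{\square_i\}$ and $X$ containing $\square_1,\dots,\square_m$ and no other hole; $c(s_1,\dots,s_m)$ replaces each $\square_i$ by $s_i$; for a 1-context $c$, $c^0=\square_1$, $c^{n+1}=c(c^n)$; $\chi^{(1)}$ is the set of 1-contexts without variables. Programs, rewriting: a program is a set of rules $(u,\bar v)$, $\bar v$ a finite sequence $\langle\dots\rangle$ of terms; binary rules are written $(u,v)$, $v\in T(\Sigma,X)\cup\{\mathsf{e}\}$. $[r]$ is the set of renamings of $r$, $[U]=\bigcup_{r\in U}[r]$; $\bar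 r\ll_S U$ means $\bar r$ is a sequence of elements of $U$ variable disjoint from $S$ and from each other. $\Rightarrow_r=\{(\langle s\rangle\bar s,(\bar v\bar s)\theta)\mid\langle(u,\bar v)\rangle\ll_{\langle s\rangle\bar s}[r],\theta\in\mathit{mgu}(u,s)\}$, $\Rightarrow_P=\bigcup_{r\in P}\Rightarrow_r$. $\mathit{id}$ is the set of rules $(\mathsf{f}(x_1,\dots,x_m),\mathsf{f}(x_1,\dots,x_m))$ with distinct $x_i$. $T_P^\beta(U)=[\{(u,\mathsf{e})\in P\}]\cup[\{(u\theta,v\theta)\mid (u,\langle v_1,\dots,v_m\rangle)=r\in P,\ 1\le i\le m,\ \langle(u_1,\mathsf{e}),\dots,(u_{i-1},\mathsf{e}),(u_i,v)\rangle\ll_r U\cup\mathit{id},\ v\ne\mathsf{e}\text{ if }i<m,\ \theta\in\mathit{mgu}(\langle u_1..u_i\rangle,\langle v_1..v_i\rangle)\}]$; $\mathit{binunf}(P)=\bigcup_n(T_P^\beta)^n(\emptyset)$. Patterns: a pattern substitution is $(\sigma,\mu)$ with $(\sigma,\mu)(n)=\sigma^n\mu$; a pattern term is $p=(s,(\sigma,\mu))$, $s\in T(\Sigma,X)\cup\{\mathsf{e}\}$, $p(n)=s\sigma^n\mu$, $\mathit{Var}(p)=\mathit{Var}(s)\cup\mathit{Var}(\sigma)\cup\mathit{Var}(\mu)$; $\widehat{s}=(s,(\emptyset,\emptyset))$. A pattern rule $r=(p,q)$ has $\mathit{rules}(r)=\{(p(n),q(n))\mid n\in\mathbb N\}$;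 it is correct w.r.t. $P$ if $\mathit{rules}(r)\subseteq\mathit{binunf}(P)$ (a set is correct if all elements are). A pattern substitution is an mgu of two sequences of pattern terms if its $n$-th instance is an mgu of the $n$-th instances for every $n$. $[r]=\{r'\mid\mathit{rules}(r')\subseteq[\mathit{rules}(r)]\}$ for pattern rules; $\mathit{patid}=\{(\widehat{\mathsf{f}(x_1..x_m)},\widehat{\mathsf{f}(x_1..x_m)})\}$. $T^\pi_{P,B}(U)=[B]\cup[\{((u,(\sigma,\mu)),(v,(\sigma_i\sigma,\mu_i\mu)))\mid r=(u,\langle v_1..v_m\rangle)\in P,\ 1\le i\le m,\ \langle(p_1,\widehat{\mathsf{e}}),\dots,(p_{i-1},\widehat{\mathsf{e}}),(p_i,(v,(\sigma_i,\mu_i)))\rangle\ll_r U\cup\mathit{patid},\ v\ne\mathsf{e}\text{ if }i<m,\ (\sigma,\mu)\text{ an mgu of }\langle p_1..p_i\rangle,\langle\widehat{v_1}..\widehat{v_i}\rangle,\ \sigma\text{ commutes with }\sigma_i,\mu_i\}]$; $\mathit{patunf}(P,B)=\bigcup_n(T^\pi_{P,B})^n(\emptyset)$. Simple patterns: $\Upsilon$ is a set of new unary symbols $c^{a,b}$ ($c\in\chi^{(1)}$, $a,b\in\mathbb N$); for $u\in T(\Sigma\cup\Upsilon,X)$, $u(n)$ replaces each $c^{a,b}$ by the nesting $c^{a\times n+b}$; $u\sim v$ iff $u(n)=v(n)$ for all $n$, $[u]$ its class. A pattern term $p=(s,(\sigma,\mu))$ is simple if for each $x\in\mathit{Var}(s)$,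 $\sigma(x)=c^a(x)$ and $\mu(x)=c^b(t)$ for some $c\in\chi^{(1)}$, $a,b\in\mathbb N$, $t\in T(\Sigma,X)$; then $\upsilon(p)=[s\theta_p]$ with $\theta_p(x)=\mu(x)$ if $\sigma(x)=x$ and $\theta_p(x)=c^{a,b}(t)$ otherwise. A pattern rule is simple if both components are. Special rules: a pattern rule $r=(p,q)$ is special if it is simple and there exist an $m$-context $c$ with $\mathit{Var}(c)=\emptyset$, $c_1,\dots,c_m\in\chi^{(1)}$, naturals $a_i,b_i,a'_i,b'_i$, terms $t_1,\dots,t_m\in T(\Sigma,X)$ and $\rho\in S(\Sigma,X)$ with $c(c_1^{a_1,b_1}(t_1),\dots,c_m^{a_m,b_m}(t_m))\in\upsilon(p)$ and $c(c_1^{a'_1,b'_1}(t_1\rho),\dots,c_m^{a'_m,b'_m}(t_m\rho))\in\upsilon(q)$ such that: (1) each $t_i$ is a variable or a ground term; (2) if $t_i\in X$ and $t_i=t_j$ then $c_i=c_j$; (3) $\{(a_i,a'_i)\mid t_i\text{ ground}\}=\{(h,h)\}$ for some $h>0$ and $\{(a_i,a'_i)\mid t_i\in X\}=\{(a,a')\}$ with $a\le a'$; (4) $\{(b_i,b'_i)\mid t_i\text{ ground}\}=\{(b,b')\}$ with $b\le b'$ and $\{(b_i,b'_i)\mid t_i\in X\}=\{(d,d')\}$; (5) $k=(b'-b)/h\in\mathbb N$, and $a=a'$ implies $0\le(d'-d)-a\times k$. Then $\alpha(r)=0$ if $a=a'$ and $\alpha(r)=\frac{a\times k-(d'-d)}{a'-a}$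 otherwise. -}

module Defs where

open import Data.Nat using (ℕ; zero; suc; _+_; _*_; _∸_; _≤_; _<_)
open import Data.Fin using (Fin)
open import Data.Vec using (Vec; []; _∷_; lookup)
import Data.Vec as Vec
open import Data.List using (List; []; _∷_; _++_; map; length; take; [_])
open import Data.List.Relation.Unary.All using (All)
open import Data.List.Relation.Unary.Any using (Any)
open import Data.List.Relation.Unary.AllPairs using (AllPairs)
open import Data.List.Membership.Propositional using (_∉_)
open import Data.List.Membership.Propositional.Properties using (∈-++⁺ˡ; ∈-++⁺ʳ)
open import Data.Product using (Σ; ∃; ∃-syntax; _×_; _,_; proj₁; proj₂)
open import Data.Sum using (_⊎_)
open import Data.Empty using (⊥)
open import Data.Unit using (⊤; tt)
open import Relation.Nullary using (¬_)
open import Relation.Binary.PropositionalEquality using (_≡_; _≢_; refl)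
open import Function.Definitions using (Bijective)

record Signature : Set₁ where
  field
    Fun   : Set
    arity : Fun → ℕ

module WithSig (Sg : Signature) where
  open Signature Sg

  -- Terms over Σ, variables X = ℕ, and holes of type H.
  -- T(Σ,X) = Tm ⊥ ; m-contexts live in Tm (Fin m) ; 1-contexts in Tm ⊤.

  data Tm (H : Set) : Set where
    var  : ℕ → Tm H
    hole : H → Tm H
    fn   : (f : Fun) → Vec (Tm H) (arity f) → Tm H

  Term : Set
  Term = Tm ⊥

  mutual
    bind : {H K : Set} → (ℕ → Tm K) → (H → Tm K) → Tm H → Tm K
    bind σ τ (var x)   = σ x
    bind σ τ (hole h)  = τ h
    bind σ τ (fn f ts) = fn f (bindV σ τ ts)

    bindV : {H K : Set} {n : ℕ} → (ℕ → Tm K) → (H → Tm K) → Vec (Tm H) n → Vec (Tm K) n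
    bindV σ τ []       = []
    bindV σ τ (t ∷ ts) = bind σ τ t ∷ bindV σ τ ts

  noHole : ⊥ → Term
  noHole ()

  data Occ {H : Set} (x : ℕ) : Tm H → Set where
    here  : Occ x (var x)
    under : ∀ {f} {ts : Vec (Tm H) (arity f)} (i : Fin (arity f)) →
            Occ x (lookup ts i) → Occ x (fn f ts)

  data HoleOcc {H : Set} (h : H) : Tm H → Set where
    here  : HoleOcc h (hole h)
    under : ∀ {f} {ts : Vec (Tm H) (arity f)} (i : Fin (arity f)) →
            HoleOcc h (lookup ts i) → HoleOcc h (fn f ts)

  Ground : Term → Set
  Ground t = ∀ x → ¬ Occ x t

  IsVar : Term → Set
  IsVar t = ∃[ x ] (t ≡ var x)

  record Subst : Set where
    constructor mkS
    field
      app   : ℕ → Term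
      dom   : List ℕ
      fixed : ∀ x → x ∉ dom → app x ≡ var x
  open Subst public

  sub : Term → Subst → Term
  sub t θ = bind (app θ) noHole t

  _⨾_ : Subst → Subst → Subst
  σ ⨾ θ = mkS (λ x → sub (app σ x) θ) (dom σ ++ dom θ) fx
    where
      fx : ∀ x → x ∉ dom σ ++ dom θ → sub (app σ x) θ ≡ var x
      fx x h rewrite fixed σ x (λ m → h (∈-++⁺ˡ m)) = fixed θ x (λ m → h (∈-++⁺ʳ (dom σ) m))

  idS : Subst
  idS = mkS var [] (λ _ _ → refl)

  pow : Subst → ℕ → Subst
  pow σ zero    = idS
  pow σ (suc n) = pow σ n ⨾ σ

  _≈S_ : Subst → Subst → Set
  σ ≈S θ = ∀ x → app σ x ≡ app θ x

  Commutes : Subst → Subst → Set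
  Commutes σ θ = ∀ x → sub (app σ x) θ ≡ sub (app θ x) σ

  VarS : Subst → ℕ → Set
  VarS σ x = (app σ x ≢ var x) ⊎ (∃[ y ] (app σ y ≢ var y × Occ x (app σ y)))

  IsRenaming : Subst → Set
  IsRenaming ρ = Σ (ℕ → ℕ) λ f → (∀ x → app ρ x ≡ var (f x)) × Bijective _≡_ _≡_ f

  data TE : Set where
    e  : TE
    tm : Term → TE

  subTE : TE → Subst → TE
  subTE e      θ = e
  subTE (tm t) θ = tm (sub t θ)

  OccTE : ℕ → TE → Set
  OccTE x e      = ⊥
  OccTE x (tm t) = Occ x t

  -- ⟨ s ⟩ : the one-element sequence, where e also denotes the empty sequence
  seqOf : TE → List Term
  seqOf e      = []
  seqOf (tm t) = t ∷ []

  VarSet : Set₁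
  VarSet = ℕ → Set

  Disjoint : VarSet → VarSet → Set
  Disjoint A B = ∀ x → A x → B x → ⊥

  VarL : List Term → VarSet
  VarL ts x = Any (Occ x) ts

  Apart : {A : Set} → (A → VarSet) → (A → Set) → VarSet → List A → Set
  Apart V U S xs = All U xs × All (λ a → Disjoint (V a) S) xs
                   × AllPairs (λ a b → Disjoint (V a) (V b)) xs

  Unifier : Subst → List TE → List TE → Set
  Unifier θ ss ts = map (λ s → subTE s θ) ss ≡ map (λ t → subTE t θ) ts

  MGU : Subst → List TE → List TE → Set
  MGU θ ss ts = Unifier θ ss ts
              × (∀ η → Unifier η ss ts → ∃[ δ ] (η ≈S (θ ⨾ δ)))

  Rule : Set
  Rule = Term × List Term

  Program : Set₁
  Program = Rule → Set

  VarRule : Rule → VarSet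
  VarRule (u , vs) x = Occ x u ⊎ VarL vs x

  renRule : Rule → Subst → Rule
  renRule (u , vs) ρ = sub u ρ , map (λ v → sub v ρ) vs

  VariantR : Rule → Rule → Set
  VariantR r r' = ∃[ ρ ] (IsRenaming ρ × r' ≡ renRule r ρ)

  data Step (P : Program) : List Term → List Term → Set where
    step : ∀ {r s ss u vs θ} → P r →
           Apart VarRule (VariantR r) (VarL (s ∷ ss)) ((u , vs) ∷ []) →
           MGU θ (tm u ∷ []) (tm s ∷ []) →
           Step P (s ∷ ss) (map (λ t → sub t θ) (vs ++ ss))

  InfChain : Program → List Term → Set
  InfChain P start = Σ (ℕ → List Term) λ f →
                       f 0 ≡ start × (∀ i → Step P (f i) (f (suc i)))

  BRule : Set
  BRule = Term × TE

  VarB : BRule → VarSet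
  VarB (u , v) x = Occ x u ⊎ OccTE x v

  renB : BRule → Subst → BRule
  renB (u , v) ρ = sub u ρ , subTE v ρ

  RenClosB : (BRule → Set) → BRule → Set
  RenClosB U b = ∃[ b₀ ] (U b₀ × ∃[ ρ ] (IsRenaming ρ × b ≡ renB b₀ ρ))

  DistinctV : ∀ {n} → Vec ℕ n → Set
  DistinctV xs = ∀ i j → lookup xs i ≡ lookup xs j → i ≡ j

  IdRule : BRule → Set
  IdRule b = Σ Fun λ f → Σ (Vec ℕ (arity f)) λ xs →
               DistinctV xs × proj₁ b ≡ fn f (Vec.map var xs) × proj₂ b ≡ tm (fn f (Vec.map var xs))

  TβBase : Program → BRule → Set
  TβBase P b = ∃[ u ] (P (u , []) × b ≡ (u , e))

  record TβNew (P : Program) (U : BRule → Set) (b : BRule) : Set where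
    field
      u   : Term
      vs  : List Term
      inP : P (u , vs)
      us  : List Term
      ui  : Term
      v   : TE
      θ   : Subst
      i≤m : suc (length us) ≤ length vs
      i<m⇒v≢e : suc (length us) < length vs → v ≢ e
      apart : Apart VarB (λ b' → U b' ⊎ IdRule b') (VarRule (u , vs))
                (map (λ t → (t , e)) us ++ ((ui , v) ∷ []))
      mgu : MGU θ (map tm (us ++ (ui ∷ []))) (map tm (take (suc (length us)) vs))
      result : b ≡ (sub u θ , subTE v θ)

  Tβ : Program → (BRule → Set) → BRule → Set
  Tβ P U b = RenClosB (TβBase P) b ⊎ RenClosB (TβNew P U) b

  TβIter : Program → ℕ → BRule → Set
  TβIter P zero    b = ⊥
  TβIter P (suc n) b = Tβ P (TβIter P n) b

  BinUnf : Program → BRule → Set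
  BinUnf P b = ∃[ n ] TβIter P n b

  PatSubst : Set
  PatSubst = Subst × Subst

  instPS : PatSubst → ℕ → Subst
  instPS (σ , μ) n = pow σ n ⨾ μ

  PatTerm : Set
  PatTerm = TE × PatSubst

  instP : PatTerm → ℕ → TE
  instP (s , ps) n = subTE s (instPS ps n)

  VarPT : PatTerm → VarSet
  VarPT (s , (σ , μ)) x = OccTE x s ⊎ VarS σ x ⊎ VarS μ x

  hat : TE → PatTerm
  hat s = s , (idS , idS)

  PatRule : Set
  PatRule = PatTerm × PatTerm

  VarPR : PatRule → VarSet
  VarPR (p , q) x = VarPT p x ⊎ VarPT q x

  RulesOf : PatRule → BRule → Set
  RulesOf (p , q) (u , v) = ∃[ n ] (instP p n ≡ tm u × instP q n ≡ v)

  Correct : Program → (PatRule → Set) → Set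
  Correct P B = ∀ r → B r → ∀ b → RulesOf r b → BinUnf P b

  -- r' ∈ [r]  iff  rules(r') ⊆ [rules(r)]
  PatVariant : PatRule → PatRule → Set
  PatVariant r r' = ∀ b → RulesOf r' b →
                    ∃[ b₀ ] (RulesOf r b₀ × ∃[ ρ ] (IsRenaming ρ × b ≡ renB b₀ ρ))

  RenClosP : (PatRule → Set) → PatRule → Set
  RenClosP U r' = ∃[ r ] (U r × PatVariant r r')

  PatId : PatRule → Set
  PatId r = Σ Fun λ f → Σ (Vec ℕ (arity f)) λ xs →
              DistinctV xs × r ≡ (hat (tm (fn f (Vec.map var xs))) , hat (tm (fn f (Vec.map var xs))))

  PatMGU : PatSubst → List PatTerm → List PatTerm → Set
  PatMGU ps ss ts = ∀ n → MGU (instPS ps n) (map (λ p → instP p n) ss) (map (λ p → instP p n) ts)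

  record TπNew (P : Program) (U : PatRule → Set) (r' : PatRule) : Set where
    field
      u   : Term
      vs  : List Term
      inP : P (u , vs)
      ps  : List PatTerm
      pi  : PatTerm
      v   : TE
      σi  : Subst
      μi  : Subst
      σ   : Subst
      μ   : Subst
      i≤m : suc (length ps) ≤ length vs
      i<m⇒v≢e : suc (length ps) < length vs → v ≢ e
      apart : Apart VarPR (λ r'' → U r'' ⊎ PatId r'') (VarRule (u , vs))
                (map (λ p → (p , hat e)) ps ++ ((pi , (v , (σi , μi))) ∷ []))
      mgu : PatMGU (σ , μ) (ps ++ (pi ∷ [])) (map (λ t → hat (tm t)) (take (suc (length ps)) vs))
      commσ : Commutes σ σi
      commμ : Commutes σ μi
      result : r' ≡ ((tm u , (σ , μ)) , (v , (σi ⨾ σ , μi ⨾ μ)))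

  Tπ : Program → (PatRule → Set) → (PatRule → Set) → PatRule → Set
  Tπ P B U r = RenClosP B r ⊎ RenClosP (TπNew P U) r

  TπIter : Program → (PatRule → Set) → ℕ → PatRule → Set
  TπIter P B zero    r = ⊥
  TπIter P B (suc n) r = Tπ P B (TπIter P B n) r

  PatUnf : Program → (PatRule → Set) → PatRule → Set
  PatUnf P B r = ∃[ n ] TπIter P B n r

  Ctx1 : Set
  Ctx1 = Σ (Tm ⊤) λ c → (∀ x → ¬ Occ x c) × HoleOcc tt c

  plug : Tm ⊤ → Term → Term
  plug c t = bind var (λ _ → t) c

  iterC : Tm ⊤ → ℕ → Term → Term
  iterC c zero    t = t
  iterC c (suc k) t = plug c (iterC c k t)

  -- T(Σ ∪ Υ, X), with ups c a b standing for the unary symbol c^{a,b}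
  data UTm : Set where
    uvar : ℕ → UTm
    ufn  : (f : Fun) → Vec UTm (arity f) → UTm
    ups  : Ctx1 → ℕ → ℕ → UTm → UTm

  mutual
    uinst : UTm → ℕ → Term
    uinst (uvar x)      n = var x
    uinst (ufn f us)    n = fn f (uinstV us n)
    uinst (ups c a b u) n = iterC (proj₁ c) (a * n + b) (uinst u n)

    uinstV : ∀ {k} → Vec UTm k → ℕ → Vec Term k
    uinstV []       n = []
    uinstV (u ∷ us) n = uinst u n ∷ uinstV us n

  _∼_ : UTm → UTm → Set
  u ∼ v = ∀ n → uinst u n ≡ uinst v n

  mutual
    usub : Term → (ℕ → UTm) → UTm
    usub (var x)   θ = θ x
    usub (hole ()) θ
    usub (fn f ts) θ = ufn f (usubV ts θ)

    usubV : ∀ {k} → Vec Term k → (ℕ → UTm) → Vec UTm k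
    usubV []       θ = []
    usubV (t ∷ ts) θ = usub t θ ∷ usubV ts θ

  embed : Term → UTm
  embed t = usub t uvar

  mutual
    plugU : ∀ {m} → Tm (Fin m) → (Fin m → UTm) → UTm
    plugU (var x)   us = uvar x
    plugU (hole i)  us = us i
    plugU (fn f ts) us = ufn f (plugUV ts us)

    plugUV : ∀ {m k} → Vec (Tm (Fin m)) k → (Fin m → UTm) → Vec UTm k
    plugUV []       us = []
    plugUV (t ∷ ts) us = plugU t us ∷ plugUV ts us

  record SimpleW (p : PatTerm) : Set where
    field
      ctx : ℕ → Ctx1
      ea  : ℕ → ℕ
      eb  : ℕ → ℕ
      arg : ℕ → Term
      ok  : ∀ x → OccTE x (proj₁ p) →
            app (proj₁ (proj₂ p)) x ≡ iterC (proj₁ (ctx x)) (ea x) (var x)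
            × app (proj₂ (proj₂ p)) x ≡ iterC (proj₁ (ctx x)) (eb x) (arg x)

  Simple : PatTerm → Set
  Simple p = SimpleW p

  -- θ_p (up to ∼; when σ(x) = x the term c^{a,b}(t) is ∼-equal to μ(x))
  θW : ∀ {p} → SimpleW p → ℕ → UTm
  θW w x = ups (SimpleW.ctx w x) (SimpleW.ea w x) (SimpleW.eb w x) (embed (SimpleW.arg w x))

  InUps : UTm → PatTerm → Set
  InUps u p = ∃[ s ] (proj₁ p ≡ tm s × Σ (SimpleW p) λ w → u ∼ usub s (θW w))

  record Special (r : PatRule) : Set where
    field
      simpleP : Simple (proj₁ r)
      simpleQ : Simple (proj₂ r)
      m       : ℕ
      c       : Tm (Fin m)
      cNoVar  : ∀ x → ¬ Occ x c
      cHoles  : ∀ i → HoleOcc i c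
      cs      : Fin m → Ctx1
      a b a' b' : Fin m → ℕ
      t       : Fin m → Term
      ρ       : Subst
      inP     : InUps (plugU c (λ i → ups (cs i) (a i) (b i) (embed (t i)))) (proj₁ r)
      inQ     : InUps (plugU c (λ i → ups (cs i) (a' i) (b' i) (embed (sub (t i) ρ)))) (proj₂ r)
      cond1   : ∀ i → IsVar (t i) ⊎ Ground (t i)
      cond2   : ∀ i j → IsVar (t i) → t i ≡ t j → proj₁ (cs i) ≡ proj₁ (cs j)
      h       : ℕ
      h>0     : 0 < h
      gAll    : ∀ i → Ground (t i) → a i ≡ h × a' i ≡ h
      gSome   : ∃[ i ] Ground (t i)
      aV a'V  : ℕ
      vAll    : ∀ i → IsVar (t i) → a i ≡ aV × a' i ≡ a'V
      vSome   : ∃[ i ] IsVar (t i)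
      aV≤a'V  : aV ≤ a'V
      bG b'G  : ℕ
      gAllb   : ∀ i → Ground (t i) → b i ≡ bG × b' i ≡ b'G
      bG≤b'G  : bG ≤ b'G
      d d'    : ℕ
      vAllb   : ∀ i → IsVar (t i) → b i ≡ d × b' i ≡ d'
      -- (5)  k = (b' - b)/h ∈ ℕ ; a = a' ⇒ 0 ≤ (d' - d) - a k
      k       : ℕ
      kDef    : b'G ≡ bG + k * h
      cond5   : aV ≡ a'V → d + aV * k ≤ d'

  -- n ≥ α(r):  α(r) = 0 if a = a', and (a k - (d' - d)) / (a' - a) otherwise
  -- (the latter inequality multiplied out by a' - a > 0)
  AlphaLe : ∀ {r} → Special r → ℕ → Set
  AlphaLe sp n = aV ≢ a'V → aV * k + d ≤ n * (a'V ∸ aV) + d'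
    where open Special sp

{-# OPTIONS --safe #-}
-- For n ≥ α(r) one has q(n) = p(n + k)ζₙ, where ζₙ maps each variable
-- argument x = tᵢ to cᵢᴰ(xρ) with D = (a′n + d′) − (a(n + k) + d); n ≥ α(r), or condition (5)
-- when a = a′, is exactly D ≥ 0. Ground arguments need no substitution: h(n + k) + b = hn + b′.
-- By induction on the unfolding operators, every instance (p(n), q(n)) of a rule of
-- patunf(P, B) is realised: ⟨p(n)η⟩ ++ ss rewrites, in at least one step with instances of
-- clauses of P, to ⟨q(n)η⟩ ++ X ++ ss = ⟨p(n + k)ζₙη⟩ ++ X ++ ss. As n + k ≥ α(r) again, this
-- can be iterated forever, and the lifting lemma turns the resulting derivation into an
-- infinite ⇒_P-chain from ⟨p(n)θ⟩.
module Submission where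

open import Defs
open import Level using (0ℓ)
open import Data.Nat using (ℕ; zero; suc; _+_; _*_; _∸_; _≤_; _<_; z≤n; s≤s; _⊔_; _≟_; _<?_)
open import Data.Nat.Properties
  using (≤-refl; ≤-trans; <-≤-trans; <-irrefl; m≤m+n; m≤n+m; m<n+m; m≤n⇒m≤1+n;
         m≤n⇒m≤n⊔o; m≤n⇒m≤o⊔n;
         +-assoc; +-comm; *-zeroʳ; *-suc; +-monoˡ-<; +-monoʳ-≤; +-monoˡ-≤; *-monoˡ-≤;
         m+n∸n≡m; m∸n+n≡m; m+[n∸m]≡n; ∸-monoˡ-<; ≮⇒≥; module ≤-Reasoning)
open import Data.Nat.Solver using (module +-*-Solver)
open import Data.Fin using (Fin)
open import Data.Fin.Properties using (any?)
open import Data.Vec using (Vec; []; _∷_; lookup)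
open import Data.Vec.Properties using (∷-injective)
open import Data.List using (List; []; _∷_; _++_; _∷ʳ_; map; length; take; upTo; tabulate)
open import Data.List.Properties
  using (map-++; map-∘; map-cong; map-id; ++-assoc; ++-identityʳ; ∷-injectiveˡ; ∷-injectiveʳ)
open import Data.List.Relation.Unary.All using (All; []; _∷_)
import Data.List.Relation.Unary.All as All
open import Data.List.Relation.Unary.All.Properties using (map⁻; ∷ʳ⁻; ++⁺; ++⁻ˡ; ++⁻ʳ)
open import Data.List.Relation.Unary.Any using (here; there)
import Data.List.Relation.Unary.Any.Properties as Any
open import Data.List.Relation.Unary.AllPairs using ([]; _∷_)
open import Data.List.Membership.Propositional using (_∉_)
open import Data.List.Membership.Propositional.Properties using (∈-upTo⁺; ∈-++⁺ˡ; ∈-++⁺ʳ)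
open import Data.Product using (Σ; ∃-syntax; _×_; _,_; proj₁; proj₂)
open import Data.Sum using (_⊎_; inj₁; inj₂)
open import Data.Unit using (⊤)
open import Data.Empty using (⊥-elim)
open import Function.Consequences.Propositional
  using (inverseᵇ⇒bijective; strictlyInverseˡ⇒inverseˡ; strictlyInverseʳ⇒inverseʳ)
open import Relation.Nullary using (¬_; Dec; yes; no)
open import Relation.Binary.Bundles using (Setoid)
import Relation.Binary.Reasoning.Setoid as SetoidReasoning
open import Relation.Binary.Construct.Closure.ReflexiveTransitive using (Star; ε; _◅_; _◅◅_)
open import Relation.Binary.PropositionalEquality
  using (_≡_; _≢_; refl; sym; trans; cong; cong₂; subst; subst₂; module ≡-Reasoning)

open +-*-Solver using (solve; _:+_; _:*_; _:=_)

module Substitutions (Sg : Signature) where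
  open WithSig Sg

  subV : ∀ {n} → Vec Term n → Subst → Vec Term n
  subV ts θ = bindV (app θ) noHole ts

  mutual
    sub-⨾ : ∀ t σ θ → sub (sub t σ) θ ≡ sub t (σ ⨾ θ)
    sub-⨾ (var x)   σ θ = refl
    sub-⨾ (hole ()) σ θ
    sub-⨾ (fn f ts) σ θ = cong (fn f) (subV-⨾ ts σ θ)

    subV-⨾ : ∀ {n} (ts : Vec Term n) σ θ → subV (subV ts σ) θ ≡ subV ts (σ ⨾ θ)
    subV-⨾ []       σ θ = refl
    subV-⨾ (t ∷ ts) σ θ = cong₂ _∷_ (sub-⨾ t σ θ) (subV-⨾ ts σ θ)

  mutual
    sub-cong-local : ∀ t σ θ → (∀ x → Occ x t → app σ x ≡ app θ x) → sub t σ ≡ sub t θ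
    sub-cong-local (var x)   σ θ eq = eq x here
    sub-cong-local (hole ()) σ θ eq
    sub-cong-local (fn f ts) σ θ eq = cong (fn f) (subV-cong-local ts σ θ (λ x i o → eq x (under i o)))

    subV-cong-local : ∀ {n} (ts : Vec Term n) σ θ →
                      (∀ x i → Occ x (lookup ts i) → app σ x ≡ app θ x) → subV ts σ ≡ subV ts θ
    subV-cong-local []       σ θ eq = refl
    subV-cong-local (t ∷ ts) σ θ eq = cong₂ _∷_ (sub-cong-local t σ θ (λ x → eq x Fin.zero))
                                                 (subV-cong-local ts σ θ (λ x i → eq x (Fin.suc i)))

  mutual
    sub-idS : ∀ t → sub t idS ≡ t
    sub-idS (var x)   = refl
    sub-idS (hole ())
    sub-idS (fn f ts) = cong (fn f) (subV-idS ts)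

    subV-idS : ∀ {n} (ts : Vec Term n) → subV ts idS ≡ ts
    subV-idS []       = refl
    subV-idS (t ∷ ts) = cong₂ _∷_ (sub-idS t) (subV-idS ts)

  sub-id-local : ∀ t σ → (∀ x → Occ x t → app σ x ≡ var x) → sub t σ ≡ t
  sub-id-local t σ eq = trans (sub-cong-local t σ idS eq) (sub-idS t)

  sub-cong : ∀ t σ θ → σ ≈S θ → sub t σ ≡ sub t θ
  sub-cong t σ θ eq = sub-cong-local t σ θ (λ x _ → eq x)

  mutual
    Occ-sub⁻ : ∀ t θ {x} → Occ x (sub t θ) → ∃[ y ] (Occ y t × Occ x (app θ y))
    Occ-sub⁻ (var y)   θ o = y , here , o
    Occ-sub⁻ (hole ()) θ o
    Occ-sub⁻ (fn f ts) θ (under i o) with OccV-sub⁻ ts θ i o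
    ... | y , j , oy , ox = y , under j oy , ox

    OccV-sub⁻ : ∀ {n} (ts : Vec Term n) θ {x} i → Occ x (lookup (subV ts θ) i) →
                ∃[ y ] ∃[ j ] (Occ y (lookup ts j) × Occ x (app θ y))
    OccV-sub⁻ (t ∷ ts) θ Fin.zero o with Occ-sub⁻ t θ o
    ... | y , oy , ox = y , Fin.zero , oy , ox
    OccV-sub⁻ (t ∷ ts) θ (Fin.suc i) o with OccV-sub⁻ ts θ i o
    ... | y , j , oy , ox = y , Fin.suc j , oy , ox

  isVar? : ∀ x (t : Term) → Dec (t ≡ var x)
  isVar? x (var y) with y ≟ x
  ... | yes refl = yes refl
  ... | no  y≢x  = no λ { refl → y≢x refl }
  isVar? x (hole ())
  isVar? x (fn f ts) = no λ ()

  tm-injective : ∀ {s t} → tm s ≡ tm t → s ≡ t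
  tm-injective refl = refl

  subTE≡tm : ∀ s θ {t′} → subTE s θ ≡ tm t′ → ∃[ t ] (s ≡ tm t × sub t θ ≡ t′)
  subTE≡tm (tm t) θ eq = t , refl , tm-injective eq

  sub-⨾-cong : ∀ t w θ η → sub t θ ≡ sub w θ → sub t (θ ⨾ η) ≡ sub w (θ ⨾ η)
  sub-⨾-cong t w θ η eq = trans (sym (sub-⨾ t θ η)) (trans (cong (λ z → sub z η) eq) (sub-⨾ w θ η))

  subTE-⨾ : ∀ v σ θ → subTE (subTE v σ) θ ≡ subTE v (σ ⨾ θ)
  subTE-⨾ e      σ θ = refl
  subTE-⨾ (tm t) σ θ = cong tm (sub-⨾ t σ θ)

  subTE-cong : ∀ v σ θ → σ ≈S θ → subTE v σ ≡ subTE v θ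
  subTE-cong e      σ θ eq = refl
  subTE-cong (tm t) σ θ eq = cong tm (sub-cong t σ θ eq)

  subTE-idS : ∀ s → subTE s idS ≡ s
  subTE-idS e      = refl
  subTE-idS (tm t) = cong tm (sub-idS t)

  subTE≡e : ∀ v {θ} → subTE v θ ≡ e → v ≡ e
  subTE≡e e      _  = refl
  subTE≡e (tm t) ()

  ≈S-setoid : Setoid 0ℓ 0ℓ
  ≈S-setoid = record
    { Carrier       = Subst
    ; _≈_           = _≈S_
    ; isEquivalence = record
      { refl  = λ _ → refl
      ; sym   = λ eq x → sym (eq x)
      ; trans = λ eq eq′ x → trans (eq x) (eq′ x)
      }
    }

  module ≈S-Reasoning = SetoidReasoning ≈S-setoid

  ⨾-assoc : ∀ σ θ ξ → ((σ ⨾ θ) ⨾ ξ) ≈S (σ ⨾ (θ ⨾ ξ))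
  ⨾-assoc σ θ ξ x = sub-⨾ (app σ x) θ ξ

  ⨾-congˡ : ∀ σ σ′ θ → σ ≈S σ′ → (σ ⨾ θ) ≈S (σ′ ⨾ θ)
  ⨾-congˡ σ σ′ θ eq x = cong (λ t → sub t θ) (eq x)

  ⨾-congʳ : ∀ σ θ θ′ → θ ≈S θ′ → (σ ⨾ θ) ≈S (σ ⨾ θ′)
  ⨾-congʳ σ θ θ′ eq x = sub-cong (app σ x) θ θ′ eq

  pow-comm : ∀ σ τ → Commutes σ τ → ∀ m → (pow σ m ⨾ τ) ≈S (τ ⨾ pow σ m)
  pow-comm σ τ comm zero    x = sym (sub-idS (app τ x))
  pow-comm σ τ comm (suc m) = begin
    (pow σ m ⨾ σ) ⨾ τ
      ≈⟨ ⨾-assoc (pow σ m) σ τ ⟩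
    pow σ m ⨾ (σ ⨾ τ)
      ≈⟨ ⨾-congʳ (pow σ m) (σ ⨾ τ) (τ ⨾ σ) comm ⟩
    pow σ m ⨾ (τ ⨾ σ)
      ≈⟨ ⨾-assoc (pow σ m) τ σ ⟨
    (pow σ m ⨾ τ) ⨾ σ
      ≈⟨ ⨾-congˡ (pow σ m ⨾ τ) (τ ⨾ pow σ m) σ (pow-comm σ τ comm m) ⟩
    (τ ⨾ pow σ m) ⨾ σ
      ≈⟨ ⨾-assoc τ (pow σ m) σ ⟩
    τ ⨾ (pow σ m ⨾ σ) ∎
    where open ≈S-Reasoning

  pow-⨾ : ∀ σ τ → Commutes σ τ → ∀ m → pow (τ ⨾ σ) m ≈S (pow τ m ⨾ pow σ m)
  pow-⨾ σ τ comm zero    x = refl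
  pow-⨾ σ τ comm (suc m) = begin
    pow (τ ⨾ σ) m ⨾ (τ ⨾ σ)
      ≈⟨ ⨾-congˡ (pow (τ ⨾ σ) m) (τᵐ ⨾ σᵐ) (τ ⨾ σ) (pow-⨾ σ τ comm m) ⟩
    (τᵐ ⨾ σᵐ) ⨾ (τ ⨾ σ)
      ≈⟨ ⨾-assoc τᵐ σᵐ (τ ⨾ σ) ⟩
    τᵐ ⨾ (σᵐ ⨾ (τ ⨾ σ))
      ≈⟨ ⨾-congʳ τᵐ ((σᵐ ⨾ τ) ⨾ σ) (σᵐ ⨾ (τ ⨾ σ)) (⨾-assoc σᵐ τ σ) ⟨
    τᵐ ⨾ ((σᵐ ⨾ τ) ⨾ σ)
      ≈⟨ ⨾-congʳ τᵐ ((σᵐ ⨾ τ) ⨾ σ) ((τ ⨾ σᵐ) ⨾ σ)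
                 (⨾-congˡ (σᵐ ⨾ τ) (τ ⨾ σᵐ) σ (pow-comm σ τ comm m)) ⟩
    τᵐ ⨾ ((τ ⨾ σᵐ) ⨾ σ)
      ≈⟨ ⨾-congʳ τᵐ ((τ ⨾ σᵐ) ⨾ σ) (τ ⨾ (σᵐ ⨾ σ)) (⨾-assoc τ σᵐ σ) ⟩
    τᵐ ⨾ (τ ⨾ (σᵐ ⨾ σ))
      ≈⟨ ⨾-assoc τᵐ τ (σᵐ ⨾ σ) ⟨
    (τᵐ ⨾ τ) ⨾ (σᵐ ⨾ σ) ∎
    where
    open ≈S-Reasoning
    τᵐ = pow τ m
    σᵐ = pow σ m

  instPS-⨾ : ∀ σ μ σᵢ μᵢ → Commutes σ σᵢ → Commutes σ μᵢ → ∀ m →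
             (instPS (σᵢ , μᵢ) m ⨾ instPS (σ , μ) m) ≈S instPS (σᵢ ⨾ σ , μᵢ ⨾ μ) m
  instPS-⨾ σ μ σᵢ μᵢ commσ commμ m = begin
    (σᵢᵐ ⨾ μᵢ) ⨾ (σᵐ ⨾ μ)
      ≈⟨ ⨾-assoc σᵢᵐ μᵢ (σᵐ ⨾ μ) ⟩
    σᵢᵐ ⨾ (μᵢ ⨾ (σᵐ ⨾ μ))
      ≈⟨ ⨾-congʳ σᵢᵐ ((μᵢ ⨾ σᵐ) ⨾ μ) (μᵢ ⨾ (σᵐ ⨾ μ)) (⨾-assoc μᵢ σᵐ μ) ⟨
    σᵢᵐ ⨾ ((μᵢ ⨾ σᵐ) ⨾ μ)
      ≈⟨ ⨾-congʳ σᵢᵐ ((σᵐ ⨾ μᵢ) ⨾ μ) ((μᵢ ⨾ σᵐ) ⨾ μ)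
                 (⨾-congˡ (σᵐ ⨾ μᵢ) (μᵢ ⨾ σᵐ) μ (pow-comm σ μᵢ commμ m)) ⟨
    σᵢᵐ ⨾ ((σᵐ ⨾ μᵢ) ⨾ μ)
      ≈⟨ ⨾-congʳ σᵢᵐ ((σᵐ ⨾ μᵢ) ⨾ μ) (σᵐ ⨾ (μᵢ ⨾ μ)) (⨾-assoc σᵐ μᵢ μ) ⟩
    σᵢᵐ ⨾ (σᵐ ⨾ (μᵢ ⨾ μ))
      ≈⟨ ⨾-assoc σᵢᵐ σᵐ (μᵢ ⨾ μ) ⟨
    (σᵢᵐ ⨾ σᵐ) ⨾ (μᵢ ⨾ μ)
      ≈⟨ ⨾-congˡ (pow (σᵢ ⨾ σ) m) (σᵢᵐ ⨾ σᵐ) (μᵢ ⨾ μ) (pow-⨾ σ σᵢ commσ m) ⟨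
    pow (σᵢ ⨾ σ) m ⨾ (μᵢ ⨾ μ) ∎
    where
    open ≈S-Reasoning
    σᵢᵐ = pow σᵢ m
    σᵐ  = pow σ m

  pow-idS : ∀ m → pow idS m ≈S idS
  pow-idS zero    x = refl
  pow-idS (suc m) x = trans (sub-idS (app (pow idS m) x)) (pow-idS m x)

  instP-hat : ∀ s m → instP (hat s) m ≡ s
  instP-hat s m = trans (subTE-cong s (pow idS (suc m)) idS (pow-idS (suc m))) (subTE-idS s)

module Realisation (Sg : Signature) where
  open WithSig Sg
  open Substitutions Sg

  -- Resolution with an arbitrary instance of a clause: no renaming apart and no mgu.
  -- Lifting.lift turns such steps back into ⇒_P steps.
  data InstStep (P : Program) : List Term → List Term → Set where
    istep : ∀ {u vs ss} → P (u , vs) → (α : Subst) →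
            InstStep P (sub u α ∷ ss) (map (λ t → sub t α) vs ++ ss)

  InstSteps⁺ : Program → List Term → List Term → Set
  InstSteps⁺ P G H = ∃[ G₁ ] (InstStep P G G₁ × Star (InstStep P) G₁ H)

  RealisedBy : (List Term → List Term → Set) → BRule → Set
  RealisedBy _⟶_ (u , v) =
    ∀ η ss → ∃[ X ] ((sub u η ∷ ss) ⟶ (seqOf (subTE v η) ++ X ++ ss) × (v ≡ e → X ≡ []))

  Realised Realised⋆ : Program → BRule → Set
  Realised  P = RealisedBy (InstSteps⁺ P)
  Realised⋆ P = RealisedBy (Star (InstStep P))

  Realised⇒Realised⋆ : ∀ {P} b → Realised P b → Realised⋆ P b
  Realised⇒Realised⋆ b real η ss with real η ss
  ... | X , (_ , first , rest) , X≡[] = X , first ◅ rest , X≡[]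

  Realised⋆-refl : ∀ {P} u → Realised⋆ P (u , tm u)
  Realised⋆-refl u η ss = [] , ε , λ ()

  Realised-⨾ : ∀ {P} u v ρ →
    (∀ η ss → ∃[ X ] (InstSteps⁺ P (sub u (ρ ⨾ η) ∷ ss) (seqOf (subTE v (ρ ⨾ η)) ++ X ++ ss)
                      × (v ≡ e → X ≡ []))) →
    Realised P (sub u ρ , subTE v ρ)
  Realised-⨾ {P} u v ρ real η ss with real η ss
  ... | X , steps , X≡[] =
    X , subst₂ (InstSteps⁺ P) (cong (_∷ ss) (sym (sub-⨾ u ρ η)))
                              (cong (λ w → seqOf w ++ X ++ ss) (sym (subTE-⨾ v ρ η))) steps
      , λ v≡e → X≡[] (subTE≡e v v≡e)

  Realised-renB : ∀ {P} b → Realised P b → ∀ ρ → Realised P (renB b ρ)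
  Realised-renB (u , v) real ρ = Realised-⨾ u v ρ (λ η → real (ρ ⨾ η))

  Realised-fact : ∀ {P} u → P (u , []) → Realised P (u , e)
  Realised-fact u P∋u η ss = [] , (ss , istep P∋u η , ε) , λ _ → refl

  -- The selected atoms are given as images under f, which is tm for T^β and
  -- instantiation at m for T^π.
  body-rewrites : ∀ {P} {A : Set} (f : A → TE) θ η (xs : List A) x v (vs : List Term) ss →
    All (λ a → ∀ t → f a ≡ tm t → Realised P (t , e)) xs →
    (∀ t → f x ≡ tm t → Realised⋆ P (t , v)) →
    suc (length xs) ≤ length vs → (suc (length xs) < length vs → v ≢ e) →
    Unifier θ (map f (xs ∷ʳ x)) (map tm (take (suc (length xs)) vs)) →
    ∃[ X ] (Star (InstStep P) (map (λ t → sub t (θ ⨾ η)) vs ++ ss) (seqOf (subTE v (θ ⨾ η)) ++ X ++ ss)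
            × (v ≡ e → X ≡ []))
  body-rewrites {P} f θ η [] x v (w ∷ ws) ss [] last _ v-last unif
    with subTE≡tm (f x) θ (∷-injectiveˡ unif)
  ... | t , fx≡t , tθ≡wθ with last t fx≡t (θ ⨾ η) (map (λ t → sub t (θ ⨾ η)) ws ++ ss)
  ... | X , steps , X≡[] =
    X ++ ws′
      , subst₂ (Star (InstStep P)) (cong (_∷ _) (sub-⨾-cong t w θ η tθ≡wθ))
                                   (cong (seqOf (subTE v (θ ⨾ η)) ++_) (sym (++-assoc X ws′ ss))) steps
      , nothing-left ws v-last
    where
    ws′ : List Term
    ws′ = map (λ t → sub t (θ ⨾ η)) ws
    nothing-left : ∀ ws → (1 < length (w ∷ ws) → v ≢ e) → v ≡ e → X ++ map (λ t → sub t (θ ⨾ η)) ws ≡ []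
    nothing-left []      _ v≡e rewrite X≡[] v≡e = refl
    nothing-left (_ ∷ _) v-last v≡e = ⊥-elim (v-last (s≤s (s≤s z≤n)) v≡e)
  body-rewrites {P} f θ η (a ∷ xs) x v (w ∷ ws) ss (first ∷ firsts) last (s≤s i≤m) v-last unif
    with subTE≡tm (f a) θ (∷-injectiveˡ unif)
  ... | t , fa≡t , tθ≡wθ with first t fa≡t (θ ⨾ η) (map (λ t → sub t (θ ⨾ η)) ws ++ ss)
  ... | X , (_ , step₁ , steps) , X≡[] with X≡[] refl
  ... | refl with body-rewrites f θ η xs x v ws ss firsts last i≤m (λ lt → v-last (s≤s lt)) (∷-injectiveʳ unif)
  ... | Y , rest , Y≡[] =
    Y , subst (λ z → Star (InstStep P) (z ∷ _) _) (sub-⨾-cong t w θ η tθ≡wθ) (step₁ ◅ steps ◅◅ rest)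
      , Y≡[]

  clause-realised : ∀ {P u vs} {A : Set} → P (u , vs) → (f : A → TE) → ∀ θ (xs : List A) x v →
    All (λ a → ∀ t → f a ≡ tm t → Realised P (t , e)) xs →
    (∀ t → f x ≡ tm t → Realised⋆ P (t , v)) →
    suc (length xs) ≤ length vs → (suc (length xs) < length vs → v ≢ e) →
    Unifier θ (map f (xs ∷ʳ x)) (map tm (take (suc (length xs)) vs)) →
    Realised P (sub u θ , subTE v θ)
  clause-realised {u = u} {vs} P∋ f θ xs x v firsts last i≤m v-last unif = Realised-⨾ u v θ λ η ss →
    let X , steps , X≡[] = body-rewrites f θ η xs x v vs ss firsts last i≤m v-last unif
    in  X , (_ , istep P∋ (θ ⨾ η) , steps) , X≡[]

  IdRule-sides : ∀ {u v} → IdRule (u , v) → v ≡ tm u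
  IdRule-sides (_ , _ , _ , refl , refl) = refl

  Tβ-realised : ∀ {P} J b → TβIter P J b → Realised P b
  Tβ-realised zero b ()
  Tβ-realised (suc J) _ (inj₁ (_ , (u , P∋u , refl) , ρ , _ , refl)) =
    Realised-renB (u , e) (Realised-fact u P∋u) ρ
  Tβ-realised {P} (suc J) _ (inj₂ (b , R , ρ , _ , refl)) =
    Realised-renB b (subst (Realised P) (sym result) new) ρ
    where
    open TβNew R
    first : ∀ {t} → TβIter P J (t , e) ⊎ IdRule (t , e) → ∀ t′ → tm t ≡ tm t′ → Realised P (t′ , e)
    first (inj₁ b∈) _ refl = Tβ-realised J _ b∈
    first (inj₂ (_ , _ , _ , _ , ()))
    last : TβIter P J (ui , v) ⊎ IdRule (ui , v) → ∀ t → tm ui ≡ tm t → Realised⋆ P (t , v)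
    last (inj₁ b∈) _ refl = Realised⇒Realised⋆ (ui , v) (Tβ-realised J _ b∈)
    last (inj₂ id) _ refl rewrite IdRule-sides id = Realised⋆-refl ui
    new : Realised P (sub u θ , subTE v θ)
    new = let firsts , lst = ∷ʳ⁻ (proj₁ apart) in
      clause-realised inP tm θ us ui v (All.map first (map⁻ firsts)) (last lst) i≤m i<m⇒v≢e (proj₁ mgu)

  binUnf-realised : ∀ {P} b → BinUnf P b → Realised P b
  binUnf-realised b (J , b∈) = Tβ-realised J b b∈

  RulesRealised : Program → PatRule → Set
  RulesRealised P r = ∀ b → RulesOf r b → Realised P b

  PatId-sides : ∀ {p q} → PatId (p , q) → ∀ m → instP p m ≡ instP q m
  PatId-sides (_ , _ , _ , refl) m = refl

  map-instP-hat : ∀ (ts : List Term) m → map (λ p → instP p m) (map (λ t → hat (tm t)) ts) ≡ map tm ts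
  map-instP-hat []       m = refl
  map-instP-hat (t ∷ ts) m = cong₂ _∷_ (instP-hat (tm t) m) (map-instP-hat ts m)

  TπNew-realised : ∀ {P U} → (∀ r → U r → RulesRealised P r) → ∀ r → TπNew P U r → RulesRealised P r
  TπNew-realised {P} {U} U-realised r R (x , y) (m , px , qy) =
    subst₂ (λ x y → Realised P (x , y)) x≡ y≡ new
    where
    open TπNew R
    θ : Subst
    θ = instPS (σ , μ) m
    v′ : TE
    v′ = instP (v , (σi , μi)) m
    first : ∀ {p} → U (p , hat e) ⊎ PatId (p , hat e) → ∀ t → instP p m ≡ tm t → Realised P (t , e)
    first (inj₁ r∈) t pt = U-realised _ r∈ (t , e) (m , pt , refl)
    first (inj₂ (_ , _ , _ , ()))
    last : U (pi , (v , (σi , μi))) ⊎ PatId (pi , (v , (σi , μi))) →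
           ∀ t → instP pi m ≡ tm t → Realised⋆ P (t , v′)
    last (inj₁ r∈) t pt = Realised⇒Realised⋆ (t , v′) (U-realised _ r∈ (t , v′) (m , pt , refl))
    last (inj₂ id) t pt = subst (λ w → Realised⋆ P (t , w)) (trans (sym pt) (PatId-sides id m)) (Realised⋆-refl t)
    unif : Unifier θ (map (λ p → instP p m) (ps ∷ʳ pi)) (map tm (take (suc (length ps)) vs))
    unif = subst (λ ts → Unifier θ (map (λ p → instP p m) (ps ∷ʳ pi)) ts)
                 (map-instP-hat (take (suc (length ps)) vs) m) (proj₁ (mgu m))
    new : Realised P (sub u θ , subTE v′ θ)
    new = let firsts , lst = ∷ʳ⁻ (proj₁ apart) in
      clause-realised inP (λ p → instP p m) θ ps pi v′ (All.map first (map⁻ firsts)) (last lst) i≤m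
        (λ i<m v′≡e → i<m⇒v≢e i<m (subTE≡e v v′≡e)) unif
    x≡ : sub u θ ≡ x
    x≡ = tm-injective (subst (λ r → instP (proj₁ r) m ≡ tm x) result px)
    y≡ : subTE v′ θ ≡ y
    y≡ = begin
      subTE v′ θ
        ≡⟨ subTE-⨾ v _ θ ⟩
      subTE v (instPS (σi , μi) m ⨾ θ)
        ≡⟨ subTE-cong v _ _ (instPS-⨾ σ μ σi μi commσ commμ m) ⟩
      subTE v (instPS (σi ⨾ σ , μi ⨾ μ) m)
        ≡⟨ subst (λ r → instP (proj₂ r) m ≡ y) result qy ⟩
      y ∎
      where open ≡-Reasoning

  variant-realised : ∀ {P} r₀ r → RulesRealised P r₀ → PatVariant r₀ r → RulesRealised P r
  variant-realised r₀ r real variant b b∈ with variant b b∈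
  ... | b₀ , b₀∈ , ρ , _ , refl = Realised-renB b₀ (real b₀ b₀∈) ρ

  Tπ-realised : ∀ {P B} → Correct P B → ∀ n r → TπIter P B n r → RulesRealised P r
  Tπ-realised correct zero    r ()
  Tπ-realised correct (suc n) r (inj₁ (r₀ , B∋r₀ , variant)) =
    variant-realised r₀ r (λ b b∈ → binUnf-realised b (correct r₀ B∋r₀ b b∈)) variant
  Tπ-realised correct (suc n) r (inj₂ (r₀ , R , variant)) =
    variant-realised r₀ r (TπNew-realised (Tπ-realised correct n) r₀ R) variant

  patUnf-realised : ∀ {P B} → Correct P B → ∀ r → PatUnf P B r → RulesRealised P r
  patUnf-realised correct r (n , r∈) = Tπ-realised correct n r r∈

module Unification (Sg : Signature) where
  open Signature Sg
  open WithSig Sg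
  open Substitutions Sg

  mutual
    size : Term → ℕ
    size (var x)   = 1
    size (hole ())
    size (fn f ts) = suc (sizeV ts)

    sizeV : ∀ {n} → Vec Term n → ℕ
    sizeV []       = 0
    sizeV (t ∷ ts) = size t + sizeV ts

  size>0 : ∀ t → 0 < size t
  size>0 (var x)   = s≤s z≤n
  size>0 (hole ())
  size>0 (fn f ts) = s≤s z≤n

  mutual
    size-Occ : ∀ {x} t θ → Occ x t → size (app θ x) ≤ size (sub t θ)
    size-Occ (var x)   θ here        = ≤-refl
    size-Occ (fn f ts) θ (under i o) = m≤n⇒m≤1+n (size-Occ-args ts θ i o)

    size-Occ-args : ∀ {x n} (ts : Vec Term n) θ i → Occ x (lookup ts i) → size (app θ x) ≤ sizeV (subV ts θ)
    size-Occ-args (t ∷ ts) θ Fin.zero    o = ≤-trans (size-Occ t θ o) (m≤m+n _ _)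
    size-Occ-args (t ∷ ts) θ (Fin.suc i) o = ≤-trans (size-Occ-args ts θ i o) (m≤n+m _ (size (sub t θ)))

  occurs-check : ∀ {x} t θ → Occ x t → t ≢ var x → size (app θ x) < size (sub t θ)
  occurs-check (var x)   θ here        t≢x = ⊥-elim (t≢x refl)
  occurs-check (fn f ts) θ (under i o) t≢x = s≤s (size-Occ-args ts θ i o)

  Equations : Set
  Equations = List (Term × Term)

  Unifies : Subst → Equations → Set
  Unifies θ E = All (λ eq → sub (proj₁ eq) θ ≡ sub (proj₂ eq) θ) E

  IsMGU : Subst → Equations → Set
  IsMGU γ E = Unifies γ E × (∀ η → Unifies η E → ∃[ δ ] (η ≈S (γ ⨾ δ)))

  instance-size : Subst → Equations → ℕ
  instance-size η []            = 0
  instance-size η ((s , t) ∷ E) = size (sub s η) + instance-size η E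

  subEqs : Subst → Equations → Equations
  subEqs σ []            = []
  subEqs σ ((s , t) ∷ E) = (sub s σ , sub t σ) ∷ subEqs σ E

  Unifies-subEqs : ∀ σ η E → (σ ⨾ η) ≈S η → Unifies η E → Unifies η (subEqs σ E)
  Unifies-subEqs σ η []            absorb []         = []
  Unifies-subEqs σ η ((s , t) ∷ E) absorb (st ∷ sts) = eq ∷ Unifies-subEqs σ η E absorb sts
    where
    eq : sub (sub s σ) η ≡ sub (sub t σ) η
    eq = trans (sub-⨾ s σ η) (trans (sub-cong s (σ ⨾ η) η absorb)
           (trans st (sym (trans (sub-⨾ t σ η) (sub-cong t (σ ⨾ η) η absorb)))))

  Unifies-subEqs⁻ : ∀ σ γ E → Unifies γ (subEqs σ E) → Unifies (σ ⨾ γ) E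
  Unifies-subEqs⁻ σ γ []            []         = []
  Unifies-subEqs⁻ σ γ ((s , t) ∷ E) (st ∷ sts) =
    trans (sym (sub-⨾ s σ γ)) (trans st (sub-⨾ t σ γ)) ∷ Unifies-subEqs⁻ σ γ E sts

  instance-size-subEqs : ∀ σ η E → (σ ⨾ η) ≈S η → instance-size η (subEqs σ E) ≡ instance-size η E
  instance-size-subEqs σ η []            absorb = refl
  instance-size-subEqs σ η ((s , t) ∷ E) absorb =
    cong₂ _+_ (cong size (trans (sub-⨾ s σ η) (sub-cong s (σ ⨾ η) η absorb)))
              (instance-size-subEqs σ η E absorb)

  zipEqs : ∀ {n} → Vec Term n → Vec Term n → Equations
  zipEqs []       []       = []
  zipEqs (s ∷ ss) (t ∷ ts) = (s , t) ∷ zipEqs ss ts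

  Unifies-zipEqs : ∀ {n} (ss ts : Vec Term n) η → subV ss η ≡ subV ts η → Unifies η (zipEqs ss ts)
  Unifies-zipEqs []       []       η eq = []
  Unifies-zipEqs (s ∷ ss) (t ∷ ts) η eq with ∷-injective eq
  ... | st , sts = st ∷ Unifies-zipEqs ss ts η sts

  Unifies-zipEqs⁻ : ∀ {n} (ss ts : Vec Term n) η → Unifies η (zipEqs ss ts) → subV ss η ≡ subV ts η
  Unifies-zipEqs⁻ []       []       η []         = refl
  Unifies-zipEqs⁻ (s ∷ ss) (t ∷ ts) η (st ∷ sts) = cong₂ _∷_ st (Unifies-zipEqs⁻ ss ts η sts)

  instance-size-zipEqs : ∀ {n} (ss ts : Vec Term n) η E →
                         instance-size η (zipEqs ss ts ++ E) ≡ sizeV (subV ss η) + instance-size η E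
  instance-size-zipEqs []       []       η E = refl
  instance-size-zipEqs (s ∷ ss) (t ∷ ts) η E =
    trans (cong (size (sub s η) +_) (instance-size-zipEqs ss ts η E))
          (sym (+-assoc (size (sub s η)) (sizeV (subV ss η)) (instance-size η E)))

  fn-injectiveˡ : ∀ {f g} {ss : Vec Term (arity f)} {ts : Vec Term (arity g)} → fn f ss ≡ fn g ts → f ≡ g
  fn-injectiveˡ refl = refl

  fn-injectiveʳ : ∀ {f} {ss ts : Vec Term (arity f)} → fn f ss ≡ fn f ts → ss ≡ ts
  fn-injectiveʳ refl = refl

  bindVar : ℕ → Term → ℕ → Term
  bindVar x t y with y ≟ x
  ... | yes _ = t
  ... | no  _ = var y

  _↦_ : ℕ → Term → Subst
  x ↦ t = mkS (bindVar x t) (x ∷ []) unbound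
    where
    unbound : ∀ y → y ∉ x ∷ [] → bindVar x t y ≡ var y
    unbound y y∉ with y ≟ x
    ... | yes y≡x = ⊥-elim (y∉ (here y≡x))
    ... | no  _   = refl

  ↦-absorb : ∀ x t η → app η x ≡ sub t η → ((x ↦ t) ⨾ η) ≈S η
  ↦-absorb x t η ηx y with y ≟ x
  ... | yes refl = sym ηx
  ... | no  _    = refl

  ↦-unifies : ∀ x t → ¬ Occ x t → app (x ↦ t) x ≡ sub t (x ↦ t)
  ↦-unifies x t x∉t = trans bound-x (sym (sub-id-local t (x ↦ t) λ y o → bound-y y λ { refl → x∉t o }))
    where
    bound-x : bindVar x t x ≡ t
    bound-x with x ≟ x
    ... | yes _   = refl
    ... | no  x≢x = ⊥-elim (x≢x refl)
    bound-y : ∀ y → y ≢ x → bindVar x t y ≡ var y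
    bound-y y y≢x with y ≟ x
    ... | yes y≡x = ⊥-elim (y≢x y≡x)
    ... | no  _   = refl

  -- Robinson's algorithm on equations with a known unifier η: the size of the η-instances
  -- of the left-hand sides decreases at every step, and the occurs check never fails.
  mutual
    unify : ∀ n E η → Unifies η E → instance-size η E < n → ∃[ γ ] IsMGU γ E
    unify zero    E η _ ()
    unify (suc n) [] η _ _ = idS , [] , λ η′ _ → η′ , λ _ → refl
    unify (suc n) ((var x , t) ∷ E) η (xt ∷ E-unif) (s≤s lt) =
      eliminate n x t E η xt E-unif (<-≤-trans (m<n+m _ (size>0 (app η x))) lt)
    unify (suc n) ((fn f ss , var y) ∷ E) η (sy ∷ E-unif) (s≤s lt)
      with eliminate n y (fn f ss) E η (sym sy) E-unif (<-≤-trans (m<n+m _ (size>0 (sub (fn f ss) η))) lt)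
    ... | γ , (yt ∷ E-unif′) , most-general =
      γ , (sym yt ∷ E-unif′) , λ { η′ (sy′ ∷ E-unif″) → most-general η′ (sym sy′ ∷ E-unif″) }
    unify (suc n) ((fn f ss , fn g ts) ∷ E) η (st ∷ E-unif) (s≤s lt) with fn-injectiveˡ st
    ... | refl = decompose n f ss ts E η st E-unif lt
    unify (suc n) ((hole () , _) ∷ E) η _ _
    unify (suc n) ((fn f ss , hole ()) ∷ E) η _ _

    decompose : ∀ n f (ss ts : Vec Term (arity f)) E η → sub (fn f ss) η ≡ sub (fn f ts) η → Unifies η E →
                sizeV (subV ss η) + instance-size η E < n → ∃[ γ ] IsMGU γ ((fn f ss , fn f ts) ∷ E)
    decompose n f ss ts E η st E-unif lt
      with unify n (zipEqs ss ts ++ E) η (++⁺ (Unifies-zipEqs ss ts η (fn-injectiveʳ st)) E-unif)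
                 (subst (_< n) (sym (instance-size-zipEqs ss ts η E)) lt)
    ... | γ , unif , most-general =
      γ , cong (fn f) (Unifies-zipEqs⁻ ss ts γ (++⁻ˡ (zipEqs ss ts) unif)) ∷ ++⁻ʳ (zipEqs ss ts) unif
        , λ { η′ (st′ ∷ E-unif′) →
                most-general η′ (++⁺ (Unifies-zipEqs ss ts η′ (fn-injectiveʳ st′)) E-unif′) }

    eliminate : ∀ n x t E η → app η x ≡ sub t η → Unifies η E → instance-size η E < n →
                ∃[ γ ] IsMGU γ ((var x , t) ∷ E)
    eliminate n x t E η xt E-unif lt with isVar? x t
    ... | yes refl with unify n E η E-unif lt
    ...   | γ , unif , most-general = γ , refl ∷ unif , λ { η′ (_ ∷ E-unif′) → most-general η′ E-unif′ }
    eliminate n x t E η xt E-unif lt | no t≢x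
      with unify n (subEqs (x ↦ t) E) η (Unifies-subEqs (x ↦ t) η E (↦-absorb x t η xt) E-unif)
                 (subst (_< n) (sym (instance-size-subEqs (x ↦ t) η E (↦-absorb x t η xt))) lt)
    ... | γ , unif , most-general =
      (x ↦ t) ⨾ γ , xt-γ ∷ Unifies-subEqs⁻ (x ↦ t) γ E unif , most-general′
      where
      x∉t : ¬ Occ x t
      x∉t o = <-irrefl (cong size xt) (occurs-check t η o t≢x)
      xt-γ : sub (app (x ↦ t) x) γ ≡ sub t ((x ↦ t) ⨾ γ)
      xt-γ = trans (cong (λ u → sub u γ) (↦-unifies x t x∉t)) (sub-⨾ t (x ↦ t) γ)
      most-general′ : ∀ η′ → Unifies η′ ((var x , t) ∷ E) → ∃[ δ ] (η′ ≈S (((x ↦ t) ⨾ γ) ⨾ δ))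
      most-general′ η′ (xt′ ∷ E-unif′)
        with most-general η′ (Unifies-subEqs (x ↦ t) η′ E (↦-absorb x t η′ xt′) E-unif′)
      ... | δ , η′≈γδ = δ , λ y → trans (sym (↦-absorb x t η′ xt′ y))
                                    (trans (sub-cong (app (x ↦ t) y) η′ (γ ⨾ δ) η′≈γδ)
                                           (sym (sub-⨾ (app (x ↦ t) y) γ δ)))

  mgu-exists : ∀ s t η → sub s η ≡ sub t η → ∃[ γ ] MGU γ (tm s ∷ []) (tm t ∷ [])
  mgu-exists s t η st with unify (suc (instance-size η ((s , t) ∷ []))) ((s , t) ∷ []) η (st ∷ []) ≤-refl
  ... | γ , (st′ ∷ []) , most-general =
    γ , cong (λ u → tm u ∷ []) st′
      , λ η′ unif′ → most-general η′ (tm-injective (∷-injectiveˡ unif′) ∷ [])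

module Lifting (Sg : Signature) where
  open WithSig Sg
  open Substitutions Sg
  open Realisation Sg
  open Unification Sg using (mgu-exists)

  mutual
    bound : Term → ℕ
    bound (var x)   = suc x
    bound (hole ())
    bound (fn f ts) = boundV ts

    boundV : ∀ {n} → Vec Term n → ℕ
    boundV []       = 0
    boundV (t ∷ ts) = bound t ⊔ boundV ts

  mutual
    Occ⇒<bound : ∀ {x} t → Occ x t → x < bound t
    Occ⇒<bound (var x)   here        = ≤-refl
    Occ⇒<bound (fn f ts) (under i o) = Occ⇒<boundV ts i o

    Occ⇒<boundV : ∀ {x n} (ts : Vec Term n) i → Occ x (lookup ts i) → x < boundV ts
    Occ⇒<boundV (t ∷ ts) Fin.zero    o = m≤n⇒m≤n⊔o (boundV ts) (Occ⇒<bound t o)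
    Occ⇒<boundV (t ∷ ts) (Fin.suc i) o = m≤n⇒m≤o⊔n (bound t) (Occ⇒<boundV ts i o)

  boundL : List Term → ℕ
  boundL []       = 0
  boundL (t ∷ ts) = bound t ⊔ boundL ts

  VarL⇒<boundL : ∀ {x} ts → VarL ts x → x < boundL ts
  VarL⇒<boundL (t ∷ ts) (here o)  = m≤n⇒m≤n⊔o (boundL ts) (Occ⇒<bound t o)
  VarL⇒<boundL (t ∷ ts) (there a) = m≤n⇒m≤o⊔n (bound t) (VarL⇒<boundL ts a)

  VarsBelow : ℕ → List Term → Set
  VarsBelow N ts = ∀ x → VarL ts x → x < N

  -- x ↦ x + N is not surjective, so clauses are renamed apart by exchanging [0, N) and [N, 2N).
  swap : ℕ → ℕ → ℕ
  swap N x with x <? N | x <? N + N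
  ... | yes _ | _     = x + N
  ... | no  _ | yes _ = x ∸ N
  ... | no  _ | no  _ = x

  swap-low : ∀ N x → x < N → swap N x ≡ x + N
  swap-low N x x<N with x <? N
  ... | yes _   = refl
  ... | no  x≮N = ⊥-elim (x≮N x<N)

  swap-middle : ∀ N x → N ≤ x → x < N + N → swap N x ≡ x ∸ N
  swap-middle N x N≤x x<2N with x <? N | x <? N + N
  ... | yes x<N | _        = ⊥-elim (<-irrefl refl (<-≤-trans x<N N≤x))
  ... | no  _   | yes _    = refl
  ... | no  _   | no  x≮2N = ⊥-elim (x≮2N x<2N)

  swap-high : ∀ N x → ¬ x < N + N → swap N x ≡ x
  swap-high N x x≮2N with x <? N | x <? N + N
  ... | yes x<N | _       = ⊥-elim (x≮2N (<-≤-trans x<N (m≤m+n N N)))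
  ... | no  _   | yes x<2N = ⊥-elim (x≮2N x<2N)
  ... | no  _   | no  _    = refl

  swap-involutive : ∀ N x → swap N (swap N x) ≡ x
  swap-involutive N x with x <? N | x <? N + N
  ... | yes x<N | _       = trans (swap-middle N (x + N) (m≤n+m N x) (+-monoˡ-< N x<N)) (m+n∸n≡m x N)
  ... | no  x≮N | yes x<2N =
    trans (swap-low N (x ∸ N) (subst (x ∸ N <_) (m+n∸n≡m N N) (∸-monoˡ-< x<2N (≮⇒≥ x≮N))))
          (m∸n+n≡m (≮⇒≥ x≮N))
  ... | no  _   | no  x≮2N = swap-high N x x≮2N

  swapS : ℕ → Subst
  swapS N = mkS (λ x → var (swap N x)) (upTo (N + N))
                (λ x x∉ → cong var (swap-high N x (λ x<2N → x∉ (∈-upTo⁺ x<2N))))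

  swapS-renaming : ∀ N → IsRenaming (swapS N)
  swapS-renaming N = swap N , (λ _ → refl) ,
    inverseᵇ⇒bijective (strictlyInverseˡ⇒inverseˡ (swap N) (swap-involutive N)
                       , strictlyInverseʳ⇒inverseʳ (swap N) (swap-involutive N))

  VarL-swapS : ∀ N ts {x} → VarsBelow N ts → VarL (map (λ t → sub t (swapS N)) ts) x → N ≤ x
  VarL-swapS N (t ∷ ts) below (here o) with Occ-sub⁻ t (swapS N) o
  ... | y , oy , here rewrite swap-low N y (below y (here oy)) = m≤n+m N y
  VarL-swapS N (t ∷ ts) below (there a) = VarL-swapS N ts (λ x a → below x (there a)) a

  glue : ℕ → Subst → Subst → ℕ → Term
  glue N α δ x with x <? N | x <? N + N
  ... | yes _ | _     = app δ x
  ... | no  _ | yes _ = app α (x ∸ N)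
  ... | no  _ | no  _ = app δ x

  glueS : ℕ → Subst → Subst → Subst
  glueS N α δ = mkS (glue N α δ) (upTo (N + N) ++ dom δ) unbound
    where
    unbound : ∀ x → x ∉ upTo (N + N) ++ dom δ → glue N α δ x ≡ var x
    unbound x x∉ with x <? N | x <? N + N
    ... | yes x<N | _       = ⊥-elim (x∉ (∈-++⁺ˡ (∈-upTo⁺ (<-≤-trans x<N (m≤m+n N N)))))
    ... | no  _   | yes x<2N = ⊥-elim (x∉ (∈-++⁺ˡ (∈-upTo⁺ x<2N)))
    ... | no  _   | no  _    = fixed δ x (λ x∈ → x∉ (∈-++⁺ʳ (upTo (N + N)) x∈))

  glue-low : ∀ N α δ x → x < N → glue N α δ x ≡ app δ x
  glue-low N α δ x x<N with x <? N
  ... | yes _   = refl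
  ... | no  x≮N = ⊥-elim (x≮N x<N)

  glue-swapped : ∀ N α δ x → x < N → glue N α δ (swap N x) ≡ app α x
  glue-swapped N α δ x x<N rewrite swap-low N x x<N with (x + N) <? N | (x + N) <? N + N
  ... | yes x+N<N | _        = ⊥-elim (<-irrefl refl (<-≤-trans x+N<N (m≤n+m N x)))
  ... | no  _     | yes _    = cong (app α) (m+n∸n≡m x N)
  ... | no  _     | no  x+N≮2N = ⊥-elim (x+N≮2N (+-monoˡ-< N x<N))

  map-sub-glueS : ∀ N α δ ts → VarsBelow N ts →
                  map (λ t → sub t (glueS N α δ)) ts ≡ map (λ t → sub t δ) ts
  map-sub-glueS N α δ []       below = refl
  map-sub-glueS N α δ (t ∷ ts) below =
    cong₂ _∷_ (sub-cong-local t (glueS N α δ) δ (λ x o → glue-low N α δ x (below x (here o))))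
              (map-sub-glueS N α δ ts (λ x a → below x (there a)))

  map-sub-swapS-glueS : ∀ N α δ ts → VarsBelow N ts →
    map (λ t → sub t (glueS N α δ)) (map (λ t → sub t (swapS N)) ts) ≡ map (λ t → sub t α) ts
  map-sub-swapS-glueS N α δ []       below = refl
  map-sub-swapS-glueS N α δ (t ∷ ts) below =
    cong₂ _∷_ (trans (sub-⨾ t (swapS N) (glueS N α δ))
                     (sub-cong-local t (swapS N ⨾ glueS N α δ) α
                        (λ x o → glue-swapped N α δ x (below x (here o)))))
              (map-sub-swapS-glueS N α δ ts (λ x a → below x (there a)))

  swapS-apart : ∀ N A ss u vs → VarsBelow N (A ∷ ss) → VarsBelow N (u ∷ vs) →
    Apart VarRule (VariantR (u , vs)) (VarL (A ∷ ss)) ((sub u (swapS N) , map (λ t → sub t (swapS N)) vs) ∷ [])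
  swapS-apart N A ss u vs goal-below rule-below =
      ((swapS N , swapS-renaming N , refl) ∷ [])
    , ((λ x x∈rule x∈goal → <-irrefl refl (<-≤-trans (goal-below x x∈goal)
                                              (VarL-swapS N (u ∷ vs) rule-below (rule-occ x∈rule)))) ∷ [])
    , ([] ∷ [])
    where
    rule-occ : ∀ {x} → VarRule (sub u (swapS N) , map (λ t → sub t (swapS N)) vs) x →
               VarL (map (λ t → sub t (swapS N)) (u ∷ vs)) x
    rule-occ (inj₁ o) = here o
    rule-occ (inj₂ a) = there a

  -- With the clause renamed apart by swapS N, glueS N α δ unifies its head with the selected
  -- atom; so an mgu γ exists, and glueS N α δ ≈S γ ⨾ δ′ provides the new instance δ′.
  lift : ∀ {P} G δ {g g′} → map (λ t → sub t δ) G ≡ g → InstStep P g g′ →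
         ∃[ G′ ] (Step P G G′ × ∃[ δ′ ] (map (λ t → sub t δ′) G′ ≡ g′))
  lift {P} (A ∷ ss) δ Gδ≡g (istep {u} {vs} {ss′} P∋ α) =
    map (λ t → sub t γ) (vs′ ++ ss)
      , step {r = u , vs} {θ = γ} P∋ (swapS-apart N A ss u vs goal-below rule-below) mgu
      , δ′ , reached
    where
    N : ℕ
    N = boundL ((A ∷ ss) ++ (u ∷ vs))
    π τ : Subst
    π = swapS N
    τ = glueS N α δ
    vs′ : List Term
    vs′ = map (λ t → sub t π) vs
    goal-below : VarsBelow N (A ∷ ss)
    goal-below x a = VarL⇒<boundL ((A ∷ ss) ++ (u ∷ vs)) (Any.++⁺ˡ a)
    rule-below : VarsBelow N (u ∷ vs)
    rule-below x a = VarL⇒<boundL ((A ∷ ss) ++ (u ∷ vs)) (Any.++⁺ʳ (A ∷ ss) a)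
    goal-τ : map (λ t → sub t τ) (A ∷ ss) ≡ map (λ t → sub t δ) (A ∷ ss)
    goal-τ = map-sub-glueS N α δ (A ∷ ss) goal-below
    rule-τ : map (λ t → sub t τ) (map (λ t → sub t π) (u ∷ vs)) ≡ map (λ t → sub t α) (u ∷ vs)
    rule-τ = map-sub-swapS-glueS N α δ (u ∷ vs) rule-below
    uπτ≡Aτ : sub (sub u π) τ ≡ sub A τ
    uπτ≡Aτ = trans (∷-injectiveˡ rule-τ) (trans (sym (∷-injectiveˡ Gδ≡g)) (sym (∷-injectiveˡ goal-τ)))
    γ : Subst
    γ = proj₁ (mgu-exists (sub u π) A τ uπτ≡Aτ)
    mgu : MGU γ (tm (sub u π) ∷ []) (tm A ∷ [])
    mgu = proj₂ (mgu-exists (sub u π) A τ uπτ≡Aτ)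
    δ′ : Subst
    δ′ = proj₁ (proj₂ mgu τ (cong (λ t → tm t ∷ []) uπτ≡Aτ))
    τ≈γδ′ : τ ≈S (γ ⨾ δ′)
    τ≈γδ′ = proj₂ (proj₂ mgu τ (cong (λ t → tm t ∷ []) uπτ≡Aτ))
    reached : map (λ t → sub t δ′) (map (λ t → sub t γ) (vs′ ++ ss)) ≡ map (λ t → sub t α) vs ++ ss′
    reached = begin
      map (λ t → sub t δ′) (map (λ t → sub t γ) (vs′ ++ ss))
        ≡⟨ map-∘ (vs′ ++ ss) ⟨
      map (λ t → sub (sub t γ) δ′) (vs′ ++ ss)
        ≡⟨ map-cong (λ t → trans (sub-⨾ t γ δ′) (sym (sub-cong t τ (γ ⨾ δ′) τ≈γδ′))) (vs′ ++ ss) ⟩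
      map (λ t → sub t τ) (vs′ ++ ss)
        ≡⟨ map-++ (λ t → sub t τ) vs′ ss ⟩
      map (λ t → sub t τ) vs′ ++ map (λ t → sub t τ) ss
        ≡⟨ cong₂ _++_ (∷-injectiveʳ rule-τ) (trans (∷-injectiveʳ goal-τ) (∷-injectiveʳ Gδ≡g)) ⟩
      map (λ t → sub t α) vs ++ ss′ ∎
      where open ≡-Reasoning

  invariant⇒InfChain : ∀ {P} (Q : List Term → Set) → (∀ G → Q G → ∃[ G′ ] (Step P G G′ × Q G′)) →
                       ∀ G → Q G → InfChain P G
  invariant⇒InfChain {P} Q next G QG = (λ i → proj₁ (chain i)) , refl , λ i → proj₁ (proj₂ (next′ (chain i)))
    where
    next′ : (G : Σ (List Term) Q) → ∃[ G′ ] (Step P (proj₁ G) G′ × Q G′)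
    next′ (G , QG) = next G QG
    chain : ℕ → Σ (List Term) Q
    chain zero    = G , QG
    chain (suc i) = let G′ , _ , QG′ = next′ (chain i) in G′ , QG′

  progress⇒InfChain : ∀ {P} (Good : List Term → Set) →
    (∀ H → Good H → ∃[ H′ ] (Good H′ × InstSteps⁺ P H H′)) → ∀ G → Good G → InfChain P G
  progress⇒InfChain {P} Good progress G good with progress G good
  ... | H , good′ , G⟶⁺H =
    invariant⇒InfChain Lifts lift-first G
      (idS , H , good′ , subst (λ G → InstSteps⁺ P G H) (sym (map-sub-idS G)) G⟶⁺H)
    where
    map-sub-idS : ∀ ts → map (λ t → sub t idS) ts ≡ ts
    map-sub-idS ts = trans (map-cong sub-idS ts) (map-id ts)
    Lifts : List Term → Set
    Lifts G = ∃[ δ ] ∃[ H ] (Good H × InstSteps⁺ P (map (λ t → sub t δ) G) H)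
    lift-first : ∀ G → Lifts G → ∃[ G′ ] (Step P G G′ × Lifts G′)
    lift-first G (δ , H , good , _ , first , rest) with lift G δ refl first | rest
    ... | G′ , G⇒G′ , δ′ , G′δ′≡ | ε =
      let H′ , good′ , H⟶⁺H′ = progress H good
      in  G′ , G⇒G′ , δ′ , H′ , good′ , subst (λ G → InstSteps⁺ P G H′) (sym G′δ′≡) H⟶⁺H′
    ... | G′ , G⇒G′ , δ′ , G′δ′≡ | next ◅ rest′ =
      G′ , G⇒G′ , δ′ , H , good , subst (λ G → InstSteps⁺ P G H) (sym G′δ′≡) (_ , next , rest′)

module SimplePatterns (Sg : Signature) where
  open WithSig Sg
  open Substitutions Sg

  mutual
    sub-bind-var : ∀ {H : Set} (c : Tm H) (F : H → Term) ζ → (∀ x → ¬ Occ x c) →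
                   sub (bind var F c) ζ ≡ bind var (λ h → sub (F h) ζ) c
    sub-bind-var (var x)   F ζ no-var = ⊥-elim (no-var x here)
    sub-bind-var (hole h)  F ζ no-var = refl
    sub-bind-var (fn f ts) F ζ no-var = cong (fn f) (sub-bindV-var ts F ζ (λ x i o → no-var x (under i o)))

    sub-bindV-var : ∀ {H : Set} {n} (ts : Vec (Tm H) n) (F : H → Term) ζ → (∀ x i → ¬ Occ x (lookup ts i)) →
                    subV (bindV var F ts) ζ ≡ bindV var (λ h → sub (F h) ζ) ts
    sub-bindV-var []       F ζ no-var = refl
    sub-bindV-var (t ∷ ts) F ζ no-var = cong₂ _∷_ (sub-bind-var t F ζ (λ x → no-var x Fin.zero))
                                                   (sub-bindV-var ts F ζ (λ x i → no-var x (Fin.suc i)))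

  mutual
    bind-var-cong : ∀ {H : Set} (c : Tm H) {F F′ : H → Term} → (∀ h → F h ≡ F′ h) →
                    bind var F c ≡ bind var F′ c
    bind-var-cong (var x)   eq = refl
    bind-var-cong (hole h)  eq = eq h
    bind-var-cong (fn f ts) eq = cong (fn f) (bindV-var-cong ts eq)

    bindV-var-cong : ∀ {H : Set} {n} (ts : Vec (Tm H) n) {F F′ : H → Term} → (∀ h → F h ≡ F′ h) →
                     bindV var F ts ≡ bindV var F′ ts
    bindV-var-cong []       eq = refl
    bindV-var-cong (t ∷ ts) eq = cong₂ _∷_ (bind-var-cong t eq) (bindV-var-cong ts eq)

  iterC-sub : ∀ (c : Tm ⊤) → (∀ x → ¬ Occ x c) → ∀ k t ζ → sub (iterC c k t) ζ ≡ iterC c k (sub t ζ)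
  iterC-sub c no-var zero    t ζ = refl
  iterC-sub c no-var (suc k) t ζ =
    trans (sub-bind-var c (λ _ → iterC c k t) ζ no-var) (bind-var-cong c (λ _ → iterC-sub c no-var k t ζ))

  iterC-+ : ∀ (c : Tm ⊤) j k t → iterC c j (iterC c k t) ≡ iterC c (j + k) t
  iterC-+ c zero    k t = refl
  iterC-+ c (suc j) k t = cong (plug c) (iterC-+ c j k t)

  mutual
    uinst-embed : ∀ t n → uinst (embed t) n ≡ t
    uinst-embed (var x)   n = refl
    uinst-embed (hole ()) n
    uinst-embed (fn f ts) n = cong (fn f) (uinstV-embed ts n)

    uinstV-embed : ∀ {k} (ts : Vec Term k) n → uinstV (usubV ts uvar) n ≡ ts
    uinstV-embed []       n = refl
    uinstV-embed (t ∷ ts) n = cong₂ _∷_ (uinst-embed t n) (uinstV-embed ts n)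

  mutual
    uinst-usub : ∀ s Θ ϑ n → (∀ x → Occ x s → uinst (Θ x) n ≡ app ϑ x) → uinst (usub s Θ) n ≡ sub s ϑ
    uinst-usub (var x)   Θ ϑ n eq = eq x here
    uinst-usub (hole ()) Θ ϑ n eq
    uinst-usub (fn f ts) Θ ϑ n eq = cong (fn f) (uinstV-usub ts Θ ϑ n (λ x i o → eq x (under i o)))

    uinstV-usub : ∀ {k} (ts : Vec Term k) Θ ϑ n → (∀ x i → Occ x (lookup ts i) → uinst (Θ x) n ≡ app ϑ x) →
                  uinstV (usubV ts Θ) n ≡ subV ts ϑ
    uinstV-usub []       Θ ϑ n eq = refl
    uinstV-usub (t ∷ ts) Θ ϑ n eq = cong₂ _∷_ (uinst-usub t Θ ϑ n (λ x → eq x Fin.zero))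
                                               (uinstV-usub ts Θ ϑ n (λ x i → eq x (Fin.suc i)))

  mutual
    uinst-plugU : ∀ {m} (c : Tm (Fin m)) F n → uinst (plugU c F) n ≡ bind var (λ i → uinst (F i) n) c
    uinst-plugU (var x)   F n = refl
    uinst-plugU (hole i)  F n = refl
    uinst-plugU (fn f ts) F n = cong (fn f) (uinstV-plugUV ts F n)

    uinstV-plugUV : ∀ {m k} (ts : Vec (Tm (Fin m)) k) F n →
                    uinstV (plugUV ts F) n ≡ bindV var (λ i → uinst (F i) n) ts
    uinstV-plugUV []       F n = refl
    uinstV-plugUV (t ∷ ts) F n = cong₂ _∷_ (uinst-plugU t F n) (uinstV-plugUV ts F n)

  pow-iterC : ∀ σ x (c : Tm ⊤) → (∀ y → ¬ Occ y c) → ∀ a → app σ x ≡ iterC c a (var x) →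
              ∀ m → app (pow σ m) x ≡ iterC c (a * m) (var x)
  pow-iterC σ x c no-var a σx zero rewrite *-zeroʳ a = refl
  pow-iterC σ x c no-var a σx (suc m) = begin
    sub (app (pow σ m) x) σ
      ≡⟨ cong (λ t → sub t σ) (pow-iterC σ x c no-var a σx m) ⟩
    sub (iterC c (a * m) (var x)) σ
      ≡⟨ iterC-sub c no-var (a * m) (var x) σ ⟩
    iterC c (a * m) (app σ x)
      ≡⟨ cong (iterC c (a * m)) σx ⟩
    iterC c (a * m) (iterC c a (var x))
      ≡⟨ iterC-+ c (a * m) a (var x) ⟩
    iterC c (a * m + a) (var x)
      ≡⟨ cong (λ e → iterC c e (var x)) (trans (+-comm (a * m) a) (sym (*-suc a m))) ⟩
    iterC c (a * suc m) (var x) ∎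
    where open ≡-Reasoning

  instP-InUps : ∀ u p → InUps u p → ∀ m → instP p m ≡ tm (uinst u m)
  instP-InUps u (.(tm s) , (σ , μ)) (s , refl , w , u∼) m =
    cong tm (sym (trans (u∼ m) (uinst-usub s (θW w) (pow σ m ⨾ μ) m θW-inst)))
    where
    open SimpleW w
    θW-inst : ∀ x → Occ x s → uinst (θW w x) m ≡ app (pow σ m ⨾ μ) x
    θW-inst x o = sym (begin
      sub (app (pow σ m) x) μ
        ≡⟨ cong (λ t → sub t μ) (pow-iterC σ x c no-var (ea x) (proj₁ (ok x o)) m) ⟩
      sub (iterC c (ea x * m) (var x)) μ
        ≡⟨ iterC-sub c no-var (ea x * m) (var x) μ ⟩
      iterC c (ea x * m) (app μ x)
        ≡⟨ cong (iterC c (ea x * m)) (proj₂ (ok x o)) ⟩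
      iterC c (ea x * m) (iterC c (eb x) (arg x))
        ≡⟨ iterC-+ c (ea x * m) (eb x) (arg x) ⟩
      iterC c (ea x * m + eb x) (arg x)
        ≡⟨ cong (iterC c (ea x * m + eb x)) (uinst-embed (arg x) m) ⟨
      uinst (θW w x) m ∎)
      where
      open ≡-Reasoning
      c : Tm ⊤
      c = proj₁ (ctx x)
      no-var : ∀ y → ¬ Occ y c
      no-var = proj₁ (proj₂ (ctx x))

module SpecialRules (Sg : Signature) where
  open WithSig Sg
  open Substitutions Sg
  open Realisation Sg
  open Lifting Sg using (boundL; VarL⇒<boundL)
  open SimplePatterns Sg

  module SpecialRule {r : PatRule} (sp : Special r) where
    module S = Special sp

    p-arg q-arg : Fin S.m → UTm
    p-arg i = ups (S.cs i) (S.a i) (S.b i) (embed (S.t i))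
    q-arg i = ups (S.cs i) (S.a' i) (S.b' i) (embed (sub (S.t i) S.ρ))

    p-term q-term : ℕ → Term
    p-term = uinst (plugU S.c p-arg)
    q-term = uinst (plugU S.c q-arg)

    instP-p : ∀ n → instP (proj₁ r) n ≡ tm (p-term n)
    instP-p = instP-InUps (plugU S.c p-arg) (proj₁ r) S.inP

    instP-q : ∀ n → instP (proj₂ r) n ≡ tm (q-term n)
    instP-q = instP-InUps (plugU S.c q-arg) (proj₂ r) S.inQ

    D : ℕ → ℕ
    D n = (S.a'V * n + S.d') ∸ (S.aV * (n + S.k) + S.d)

    ζ-var : ℕ → ∀ x → Dec (∃[ j ] (S.t j ≡ var x)) → Term
    ζ-var n x (yes (j , _)) = iterC (proj₁ (S.cs j)) (D n) (app S.ρ x)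
    ζ-var n x (no _)        = var x

    argument? : ∀ x → Dec (∃[ j ] (S.t j ≡ var x))
    argument? x = any? (λ j → isVar? x (S.t j))

    ζ : ℕ → Subst
    ζ n = mkS (λ x → ζ-var n x (argument? x)) (upTo (boundL (tabulate S.t))) unbound
      where
      unbound : ∀ x → x ∉ upTo (boundL (tabulate S.t)) → ζ-var n x (argument? x) ≡ var x
      unbound x x∉ with argument? x
      ... | yes (j , tj≡x) =
        ⊥-elim (x∉ (∈-upTo⁺ (VarL⇒<boundL (tabulate S.t) (Any.tabulate⁺ j (subst (Occ x) (sym tj≡x) here)))))
      ... | no  _ = refl

    ζ-at : ∀ n i x → S.t i ≡ var x → app (ζ n) x ≡ iterC (proj₁ (S.cs i)) (D n) (app S.ρ x)
    ζ-at n i x ti≡x with argument? x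
    ... | yes (j , tj≡x) =
      cong (λ c → iterC c (D n) (app S.ρ x)) (S.cond2 j i (x , tj≡x) (trans tj≡x (sym ti≡x)))
    ... | no  none       = ⊥-elim (none (i , ti≡x))

    variable-exponents : ∀ n → AlphaLe sp n → S.aV * (n + S.k) + S.d ≤ S.a'V * n + S.d'
    variable-exponents n n≥α with S.aV ≟ S.a'V
    ... | yes a≡a′ = begin
      S.aV * (n + S.k) + S.d
        ≡⟨ solve 4 (λ a n k d → a :* (n :+ k) :+ d := a :* n :+ (d :+ a :* k)) refl S.aV n S.k S.d ⟩
      S.aV * n + (S.d + S.aV * S.k)
        ≤⟨ +-monoʳ-≤ (S.aV * n) (S.cond5 a≡a′) ⟩
      S.aV * n + S.d'
        ≡⟨ cong (λ a → a * n + S.d') a≡a′ ⟩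
      S.a'V * n + S.d' ∎
      where open ≤-Reasoning
    ... | no a≢a′ = begin
      S.aV * (n + S.k) + S.d
        ≡⟨ solve 4 (λ a n k d → a :* (n :+ k) :+ d := a :* n :+ (a :* k :+ d)) refl S.aV n S.k S.d ⟩
      S.aV * n + (S.aV * S.k + S.d)
        ≤⟨ +-monoʳ-≤ (S.aV * n) (n≥α a≢a′) ⟩
      S.aV * n + (n * (S.a'V ∸ S.aV) + S.d')
        ≡⟨ solve 4 (λ a n δ d′ → a :* n :+ (n :* δ :+ d′) := (a :+ δ) :* n :+ d′)
                   refl S.aV n (S.a'V ∸ S.aV) S.d' ⟩
      (S.aV + (S.a'V ∸ S.aV)) * n + S.d'
        ≡⟨ cong (λ a → a * n + S.d') (m+[n∸m]≡n S.aV≤a'V) ⟩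
      S.a'V * n + S.d' ∎
      where open ≤-Reasoning

    ground-exponents : ∀ n → S.h * (n + S.k) + S.bG ≡ S.h * n + S.b'G
    ground-exponents n =
      trans (solve 4 (λ h n k b → h :* (n :+ k) :+ b := h :* n :+ (b :+ k :* h)) refl S.h n S.k S.bG)
            (cong (S.h * n +_) (sym S.kDef))

    AlphaLe-+k : ∀ n → AlphaLe sp n → AlphaLe sp (n + S.k)
    AlphaLe-+k n n≥α a≢a′ =
      ≤-trans (n≥α a≢a′) (+-monoˡ-≤ S.d' (*-monoˡ-≤ (S.a'V ∸ S.aV) (m≤m+n n S.k)))

    argument-ζ : ∀ n → AlphaLe sp n → ∀ i → sub (uinst (p-arg i) (n + S.k)) (ζ n) ≡ uinst (q-arg i) n
    argument-ζ n n≥α i = begin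
      sub (iterC cᵢ (S.a i * (n + S.k) + S.b i) (uinst (embed (S.t i)) (n + S.k))) (ζ n)
        ≡⟨ cong (λ t → sub (iterC cᵢ (S.a i * (n + S.k) + S.b i) t) (ζ n)) (uinst-embed (S.t i) (n + S.k)) ⟩
      sub (iterC cᵢ (S.a i * (n + S.k) + S.b i) (S.t i)) (ζ n)
        ≡⟨ iterC-sub cᵢ no-var (S.a i * (n + S.k) + S.b i) (S.t i) (ζ n) ⟩
      iterC cᵢ (S.a i * (n + S.k) + S.b i) (sub (S.t i) (ζ n))
        ≡⟨ by-kind (S.cond1 i) ⟩
      iterC cᵢ (S.a' i * n + S.b' i) (sub (S.t i) S.ρ)
        ≡⟨ cong (iterC cᵢ (S.a' i * n + S.b' i)) (uinst-embed (sub (S.t i) S.ρ) n) ⟨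
      uinst (q-arg i) n ∎
      where
      open ≡-Reasoning
      cᵢ : Tm ⊤
      cᵢ = proj₁ (S.cs i)
      no-var : ∀ x → ¬ Occ x cᵢ
      no-var = proj₁ (proj₂ (S.cs i))
      by-kind : IsVar (S.t i) ⊎ Ground (S.t i) →
                iterC cᵢ (S.a i * (n + S.k) + S.b i) (sub (S.t i) (ζ n))
                  ≡ iterC cᵢ (S.a' i * n + S.b' i) (sub (S.t i) S.ρ)
      by-kind (inj₂ ground)
        rewrite sub-id-local (S.t i) (ζ n) (λ x o → ⊥-elim (ground x o))
              | sub-id-local (S.t i) S.ρ (λ x o → ⊥-elim (ground x o))
              | proj₁ (S.gAll i ground)  | proj₂ (S.gAll i ground)
              | proj₁ (S.gAllb i ground) | proj₂ (S.gAllb i ground)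
        = cong (λ e → iterC cᵢ e (S.t i)) (ground-exponents n)
      by-kind (inj₁ (x , ti≡x))
        rewrite proj₁ (S.vAll i (x , ti≡x))  | proj₂ (S.vAll i (x , ti≡x))
              | proj₁ (S.vAllb i (x , ti≡x)) | proj₂ (S.vAllb i (x , ti≡x)) | ti≡x = begin
        iterC cᵢ (S.aV * (n + S.k) + S.d) (app (ζ n) x)
          ≡⟨ cong (iterC cᵢ (S.aV * (n + S.k) + S.d)) (ζ-at n i x ti≡x) ⟩
        iterC cᵢ (S.aV * (n + S.k) + S.d) (iterC cᵢ (D n) (app S.ρ x))
          ≡⟨ iterC-+ cᵢ (S.aV * (n + S.k) + S.d) (D n) (app S.ρ x) ⟩
        iterC cᵢ (S.aV * (n + S.k) + S.d + D n) (app S.ρ x)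
          ≡⟨ cong (λ e → iterC cᵢ e (app S.ρ x)) (m+[n∸m]≡n (variable-exponents n n≥α)) ⟩
        iterC cᵢ (S.a'V * n + S.d') (app S.ρ x) ∎

    instP-q-ζ : ∀ n → AlphaLe sp n → instP (proj₂ r) n ≡ subTE (instP (proj₁ r) (n + S.k)) (ζ n)
    instP-q-ζ n n≥α = begin
      instP (proj₂ r) n
        ≡⟨ instP-q n ⟩
      tm (q-term n)
        ≡⟨ cong tm (uinst-plugU S.c q-arg n) ⟩
      tm (bind var (λ i → uinst (q-arg i) n) S.c)
        ≡⟨ cong tm (bind-var-cong S.c (argument-ζ n n≥α)) ⟨
      tm (bind var (λ i → sub (uinst (p-arg i) (n + S.k)) (ζ n)) S.c)
        ≡⟨ cong tm (sub-bind-var S.c (λ i → uinst (p-arg i) (n + S.k)) (ζ n) S.cNoVar) ⟨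
      tm (sub (bind var (λ i → uinst (p-arg i) (n + S.k)) S.c) (ζ n))
        ≡⟨ cong (λ t → tm (sub t (ζ n))) (uinst-plugU S.c p-arg (n + S.k)) ⟨
      tm (sub (p-term (n + S.k)) (ζ n))
        ≡⟨ cong (λ s → subTE s (ζ n)) (instP-p (n + S.k)) ⟨
      subTE (instP (proj₁ r) (n + S.k)) (ζ n) ∎
      where open ≡-Reasoning

    Recurrent : List Term → Set
    Recurrent H = ∃[ n ] ∃[ η ] ∃[ ss ] (AlphaLe sp n × H ≡ seqOf (subTE (instP (proj₁ r) n) η) ++ ss)

    Recurrent-progress : ∀ {P B} → Correct P B → PatUnf P B r →
                         ∀ H → Recurrent H → ∃[ H′ ] (Recurrent H′ × InstSteps⁺ P H H′)
    Recurrent-progress {P} correct r∈ _ (n , η , ss , n≥α , refl)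
      with patUnf-realised correct r r∈ (p-term n , instP (proj₂ r) n) (n , instP-p n , refl) η ss
    ... | X , steps , _ =
      _ , (n + S.k , ζ n ⨾ η , X ++ ss , AlphaLe-+k n n≥α , refl) ,
      subst₂ (λ s s′ → InstSteps⁺ P (seqOf (subTE s η) ++ ss) (seqOf s′ ++ X ++ ss))
             (sym (instP-p n))
             (trans (cong (λ s → subTE s η) (instP-q-ζ n n≥α))
                    (subTE-⨾ (instP (proj₁ r) (n + S.k)) (ζ n) η))
             steps

theorem4p15 : (Sg : Signature) → let open WithSig Sg in
    (P : Program) (B : PatRule → Set) → Correct P B →
    (r : PatRule) → PatUnf P B r → (sp : Special r) →
    (n : ℕ) → AlphaLe sp n → (θ : Subst) →
    InfChain P (seqOf (subTE (instP (proj₁ r) n) θ))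
theorem4p15 Sg P B correct r r∈ sp n n≥α θ =
  progress⇒InfChain Recurrent (Recurrent-progress correct r∈) _ (n , θ , [] , n≥α , sym (++-identityʳ _))
  where
  open Lifting Sg using (progress⇒InfChain)
  open SpecialRules.SpecialRule Sg sp using (Recurrent; Recurrent-progress)
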